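{- Let $w$ be a non-empty finite word with heart $v$. Then $w$ is a GT-word if and only if $|w| = R_v + K_v + |\mathrm{Alph}(w)| - 2$.
   Context: Words are finite sequences of letters; $|w|$ is the length of $w$ and $\mathrm{Alph}(w)$ the set of letters occurring in $w$. A factor of $w$ is a contiguous subword (the empty word included). The factor complexity $C_w(n)$ is the number of distinct factors of $w$ of length $n$ ($n\ge 0$); set $C_w(n)=0$ for $n>|w|$. A factor $u$ of $w$ is right special if $ux$ is a factor of $w$ for at least two distinct letters $x$. $R_w$ denotes the smallest positive integer $r$ such that $w$ has no right special factor of length $r$, and $K_w$ denotes the length of the shortest suffix of $w$ that occurs exactly once in $w$. A word $w$ with $|\mathrm{Alph}(w)|\ge 2$ is a generalized trapezoidal word (GT-word) if there exist positive integers $m\le M$ such that $C_w(0)=1$, $C_w(i)=|\mathrm{Alph}(w)|+i-1$ for $1\le i\le m$, $C_w(i+1)=C_w(i)$ for $m\le i\le M-1$, and $C_w(i+1)=C_w(i)-1$ for $M\le i\le |w|$. In addition, every non-empty word $w$ with $|\mathrm{Alph}(w)|=1$ is also considered a GT-word. Heart: for a non-empty word $w$, let $r$ be the longest (possibly empty) prefix of $w$ such that every letter of $r$ occurs exactly once in $w$, and $s$ the longest (possibly empty) suffix of $w$ such that every letter of $s$ occurs exactly once in $w$. If $|w|>|\mathrm{Alph}(w)|$, the heart of $w$ is the unique non-empty word $v$ with $w=rvs$; if $|w|=|\mathrm{Alph}(w)|$, the heart of $w$ is $w$ itself. -}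

module Defs where

open import Data.Nat using (ℕ; zero; suc; _+_; _∸_; _≤_; _<_; _<?_)
open import Data.Nat.Properties using () renaming (_≟_ to _≟ℕ_)
open import Data.List using (List; []; _∷_; _++_; [_]; length; take; drop; filter; deduplicate; takeWhile; reverse)
open import Data.List.Properties using (≡-dec)
open import Data.Product using (Σ; ∃; ∃₂; _×_)
open import Data.Sum using (_⊎_)
open import Relation.Binary.PropositionalEquality using (_≡_; _≢_)
open import Relation.Binary.Definitions using (DecidableEquality)
open import Relation.Nullary using (¬_)

suffixes : {A : Set} → List A → List (List A)
suffixes []       = [] ∷ []
suffixes (x ∷ xs) = (x ∷ xs) ∷ suffixes xs

Factor : {A : Set} → List A → List A → Set
Factor {A} u w = ∃₂ λ (p s : List A) → p ++ u ++ s ≡ w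

module _ {A : Set} (_≟_ : DecidableEquality A) where

  _≟w_ : DecidableEquality (List A)
  _≟w_ = ≡-dec _≟_

  windows : ℕ → List A → List (List A)
  windows n w = filter (λ u → length u ≟ℕ n) (Data.List.map (take n) (suffixes w))

  -- Factor complexity C_w(n): number of distinct factors of length n
  -- (automatically 0 for n > |w|).
  C : List A → ℕ → ℕ
  C w n = length (deduplicate _≟w_ (windows n w))

  alphSize : List A → ℕ
  alphSize w = length (deduplicate _≟_ w)

  occ : List A → List A → ℕ
  occ u w = length (filter (u ≟w_) (windows (length u) w))

  RightSpecial : List A → List A → Set
  RightSpecial u w = Σ A λ x → Σ A λ y → x ≢ y × Factor (u ++ [ x ]) w × Factor (u ++ [ y ]) w

  IsR : List A → ℕ → Set
  IsR w r = 1 ≤ r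
          × (∀ u → length u ≡ r → ¬ RightSpecial u w)
          × (∀ r' → 1 ≤ r' → r' < r → ∃ λ u → length u ≡ r' × RightSpecial u w)

  suffixOfLength : ℕ → List A → List A
  suffixOfLength k w = drop (length w ∸ k) w

  IsK : List A → ℕ → Set
  IsK w k = k ≤ length w
          × occ (suffixOfLength k w) w ≡ 1
          × (∀ j → j < k → ¬ (occ (suffixOfLength j w) w ≡ 1))

  heartPrefix : List A → List A
  heartPrefix w = takeWhile (λ a → length (filter (a ≟_) w) ≟ℕ 1) w

  heartSuffix : List A → List A
  heartSuffix w = reverse (takeWhile (λ a → length (filter (a ≟_) w) ≟ℕ 1) (reverse w))

  -- The heart of w: if |w| > |Alph(w)|, the word v with w = r v s;
  -- otherwise (|w| = |Alph(w)|) w itself.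
  heart : List A → List A
  heart w with alphSize w <? length w
  ... | Relation.Nullary.yes _ = take (length w ∸ length (heartPrefix w) ∸ length (heartSuffix w))
                                      (drop (length (heartPrefix w)) w)
  ... | Relation.Nullary.no _  = w

  GT : List A → Set
  GT w = (2 ≤ alphSize w
          × ∃₂ λ m M → 1 ≤ m × m ≤ M
            × C w 0 ≡ 1
            × (∀ i → 1 ≤ i → i ≤ m → C w i ≡ alphSize w + i ∸ 1)
            × (∀ i → m ≤ i → i + 1 ≤ M → C w (suc i) ≡ C w i)
            × (∀ i → M ≤ i → i ≤ length w → C w i ≡ suc (C w (suc i))))
       ⊎ (alphSize w ≡ 1 × w ≢ [])

module Submission where

-- All counting is done over positions: C_w(n) is the number of positions at which a window of
-- length n occurs for the first time.  For the heart v let N(n) count the positions where the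
-- window of length n + 1 occurs for the first time although its prefix of length n occurred
-- before ("branching points").  Then C_v(n+1) - C_v(n) = N(n) - [K ≤ n], and N(n) ≥ 1 exactly
-- for 1 ≤ n < R; summing gives the balance identity |Alph(v)| + Σ_{1 ≤ n < R} N(n) + K = |v| + 1.
-- Writing w = r v s, where the letters of r and of s occur only once in w, gives
-- C_w(n) = |r| + C_v(n) + |s| for 1 ≤ n ≤ |v|, while longer windows of w occur only once.
-- Hence the length equation holds iff N(n) = 1 for every 1 ≤ n < R.  In that case C_w rises up
-- to min(R, K), is constant up to max(R, K) and then falls, so w is trapezoidal; conversely a
-- trapezoidal C_w allows at most one branching point per length, by a key lemma on right
-- special factors (OneBranching) that applies because K > 1 or R = 1 for the heart.

open import Defs
open import Data.Nat using (ℕ; _+_)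
open import Data.List using (List; []; length)
open import Relation.Binary.PropositionalEquality using (_≡_; _≢_)
open import Relation.Binary.Definitions using (DecidableEquality)
open import Data.Product using (_×_)

open import Data.Nat hiding (_≟_)
open import Data.Nat.Properties hiding (_≟_)
open import Data.Nat.Properties using () renaming (_≟_ to _≟ℕ_)
open import Data.Nat.Tactic.RingSolver using (solve-∀)
open import Algebra.Properties.CommutativeSemigroup +-commutativeSemigroup using (interchange; x∙yz≈y∙xz)
open import Data.Empty using (⊥; ⊥-elim)
open import Data.Product using (_,_; proj₁; proj₂; ∃; ∃₂)
open import Data.Sum using (_⊎_; inj₁; inj₂)
open import Data.List using (_∷_; _++_; [_]; take; drop; filter; map; applyUpTo; deduplicate; takeWhile; dropWhile; reverse)
open import Data.List.Properties
  using (∷-injective; length-++; length-take; length-drop; length-map; length-reverse; take++drop≡id; drop-drop;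
         take-take; take-all; applyUpTo-∷ʳ; filter-++; filter-accept; filter-reject; ++-identityʳ; ++-cancelˡ;
         ++-assoc; takeWhile++dropWhile; reverse-++; reverse-involutive; unfold-reverse)
open import Data.List.Membership.Propositional using (_∈_; _∉_)
open import Data.List.Membership.Propositional.Properties
  using (∈-applyUpTo⁺; ∈-applyUpTo⁻; ∈-deduplicate⁺; ∈-++⁺ʳ; ∈-++⁺ˡ)
open import Data.List.Relation.Unary.Any using (here; there)
import Data.List.Relation.Unary.Any.Properties as Any
open import Data.List.Relation.Unary.All as All using (All)
open import Data.List.Relation.Unary.All.Properties using (all-takeWhile)
open import Level using (0ℓ)
open import Relation.Nullary using (Dec; yes; no; ¬_; ¬?; _×-dec_)
open import Relation.Unary using (Pred; Decidable)
open import Relation.Binary.Definitions using (tri<; tri≈; tri>)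
open import Relation.Binary.PropositionalEquality hiding ([_])

restrict : {Q : ℕ → Set} {k : ℕ} → (∀ i → i < suc k → Q i) → ∀ i → i < k → Q i
restrict h i i<k = h i (m<n⇒m<1+n i<k)

ind : {P : Set} → Dec P → ℕ
ind (yes _) = 1
ind (no _)  = 0

ind-yes : {P : Set} (d : Dec P) → P → ind d ≡ 1
ind-yes (yes _) _ = refl
ind-yes (no ¬p) p = ⊥-elim (¬p p)

ind-no : {P : Set} (d : Dec P) → ¬ P → ind d ≡ 0
ind-no (yes p) ¬p = ⊥-elim (¬p p)
ind-no (no _)  _  = refl

ind-cong : {P Q : Set} (a : Dec P) (b : Dec Q) → (P → Q) → (Q → P) → ind a ≡ ind b
ind-cong (yes _) (yes _) _ _ = refl
ind-cong (yes p) (no ¬q) f _ = ⊥-elim (¬q (f p))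
ind-cong (no ¬p) (yes q) _ g = ⊥-elim (¬p (g q))
ind-cong (no _)  (no _)  _ _ = refl

count : {P : ℕ → Set} → (∀ i → Dec (P i)) → ℕ → ℕ
count d zero    = 0
count d (suc k) = count d k + ind (d k)

module _ {P : ℕ → Set} (d : ∀ i → Dec (P i)) where

  count≤ : ∀ k → count d k ≤ k
  count≤ zero    = z≤n
  count≤ (suc k) with d k
  ... | yes _ = ≤-trans (≤-reflexive (+-comm (count d k) 1)) (s≤s (count≤ k))
  ... | no _  = ≤-trans (≤-reflexive (+-identityʳ (count d k))) (m≤n⇒m≤1+n (count≤ k))

  count-none : ∀ k → (∀ i → i < k → ¬ P i) → count d k ≡ 0
  count-none zero    h = refl
  count-none (suc k) h = cong₂ _+_ (count-none k (restrict h)) (ind-no (d k) (h k ≤-refl))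

  count-all : ∀ k → (∀ i → i < k → P i) → count d k ≡ k
  count-all zero    h = refl
  count-all (suc k) h = begin
    count d k + ind (d k) ≡⟨ cong₂ _+_ (count-all k (restrict h)) (ind-yes (d k) (h k ≤-refl)) ⟩
    k + 1                 ≡⟨ +-comm k 1 ⟩
    suc k                 ∎
    where open ≡-Reasoning

  count-+ : ∀ a b → count d (a + b) ≡ count d a + count (λ i → d (a + i)) b
  count-+ a zero    = trans (cong (count d) (+-identityʳ a)) (sym (+-identityʳ _))
  count-+ a (suc b) = begin
    count d (a + suc b)                                    ≡⟨ cong (count d) (+-suc a b) ⟩
    count d (a + b) + ind (d (a + b))                      ≡⟨ cong (_+ ind (d (a + b))) (count-+ a b) ⟩
    count d a + count (λ i → d (a + i)) b + ind (d (a + b)) ≡⟨ +-assoc (count d a) _ _ ⟩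
    count d a + (count (λ i → d (a + i)) b + ind (d (a + b))) ∎
    where open ≡-Reasoning

  ∃⇒count≥1 : ∀ k i → i < k → P i → 1 ≤ count d k
  ∃⇒count≥1 (suc k) i i<k p with d k | m≤n⇒m<n∨m≡n (≤-pred i<k)
  ... | yes _ | _         = ≤-trans (s≤s z≤n) (m≤n+m 1 (count d k))
  ... | no _  | inj₁ i<k′ = ≤-trans (∃⇒count≥1 k i i<k′ p) (m≤m+n (count d k) 0)
  ... | no ¬p | inj₂ refl = ⊥-elim (¬p p)

  count≥1⇒∃ : ∀ k → 1 ≤ count d k → ∃ λ i → i < k × P i
  count≥1⇒∃ (suc k) h with d k
  ... | yes p = k , ≤-refl , p
  ... | no _ with count≥1⇒∃ k (subst (1 ≤_) (+-identityʳ _) h)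
  ...   | i , i<k , p = i , m<n⇒m<1+n i<k , p

  ∃₂⇒count≥2 : ∀ k i j → i < j → j < k → P i → P j → 2 ≤ count d k
  ∃₂⇒count≥2 (suc k) i j i<j j<k p q with d k | m≤n⇒m<n∨m≡n (≤-pred j<k)
  ... | yes _ | inj₁ j<k′ = ≤-trans (s≤s (∃⇒count≥1 k i (<-trans i<j j<k′) p)) (≤-reflexive (+-comm 1 _))
  ... | yes _ | inj₂ refl = ≤-trans (s≤s (∃⇒count≥1 k i i<j p)) (≤-reflexive (+-comm 1 _))
  ... | no _  | inj₁ j<k′ = ≤-trans (∃₂⇒count≥2 k i j i<j j<k′ p q) (m≤m+n (count d k) 0)
  ... | no ¬q | inj₂ refl = ⊥-elim (¬q q)

  count≥2⇒∃₂ : ∀ k → 2 ≤ count d k → ∃₂ λ i j → i < j × j < k × P i × P j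
  count≥2⇒∃₂ (suc k) h with d k
  ... | yes q with count≥1⇒∃ k (≤-pred (subst (2 ≤_) (+-comm (count d k) 1) h))
  ...   | i , i<k , p = i , k , i<k , ≤-refl , p , q
  count≥2⇒∃₂ (suc k) h | no _ with count≥2⇒∃₂ k (subst (2 ≤_) (+-identityʳ _) h)
  ...   | i , j , i<j , j<k , p , q = i , j , i<j , m<n⇒m<1+n j<k , p , q

  ∃¬⇒count< : ∀ k i → i < k → ¬ P i → count d k < k
  ∃¬⇒count< (suc k) i i<k ¬p with d k | m≤n⇒m<n∨m≡n (≤-pred i<k)
  ... | yes _ | inj₁ i<k′ = s≤s (≤-trans (≤-reflexive (+-comm (count d k) 1)) (∃¬⇒count< k i i<k′ ¬p))
  ... | yes p | inj₂ refl = ⊥-elim (¬p p)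
  ... | no _  | _         = s≤s (≤-trans (≤-reflexive (+-identityʳ (count d k))) (count≤ k))

  count<⇒∃¬ : ∀ k → count d k < k → ∃ λ i → i < k × ¬ P i
  count<⇒∃¬ (suc k) lt with d k
  ... | no ¬p = k , ≤-refl , ¬p
  ... | yes _ with count<⇒∃¬ k (subst (_≤ k) (+-comm (count d k) 1) (≤-pred lt))
  ...   | i , i<k , ¬p = i , m<n⇒m<1+n i<k , ¬p

count-ext : {P Q : ℕ → Set} (d : ∀ i → Dec (P i)) (e : ∀ i → Dec (Q i)) (k : ℕ) →
            (∀ i → i < k → (P i → Q i) × (Q i → P i)) → count d k ≡ count e k
count-ext d e zero    h = refl
count-ext d e (suc k) h =
  cong₂ _+_ (count-ext d e k (restrict h)) (ind-cong (d k) (e k) (proj₁ (h k ≤-refl)) (proj₂ (h k ≤-refl)))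

count-split : {P Q : ℕ → Set} (d : ∀ i → Dec (P i)) (e : ∀ i → Dec (Q i)) (k : ℕ) →
              (∀ i → i < k → P i → Q i) →
              count e k ≡ count d k + count (λ i → e i ×-dec ¬? (d i)) k
count-split d e zero    h = refl
count-split d e (suc k) h =
  trans (cong₂ _+_ (count-split d e k (restrict h)) (step (d k) (e k) (h k ≤-refl)))
        (interchange (count d k) _ _ _)
  where
  step : {P Q : Set} (a : Dec P) (b : Dec Q) → (P → Q) → ind b ≡ ind a + ind (b ×-dec ¬? a)
  step (yes p) (yes q) f = refl
  step (yes p) (no ¬q) f = ⊥-elim (¬q (f p))
  step (no ¬p) (yes q) f = refl
  step (no ¬p) (no ¬q) f = refl

all<? : {Q : ℕ → Set} → (∀ j → Dec (Q j)) → ∀ i → Dec (∀ j → j < i → Q j)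
all<? d zero = yes (λ j ())
all<? {Q} d (suc i) with all<? d i | d i
... | yes h | yes q = yes λ j j<1+i → below (m≤n⇒m<n∨m≡n (≤-pred j<1+i))
  where
  below : ∀ {j} → j < i ⊎ j ≡ i → Q j
  below (inj₁ j<i)  = h _ j<i
  below (inj₂ refl) = q
... | yes h | no ¬q = no λ h′ → ¬q (h′ i ≤-refl)
... | no ¬h | _     = no λ h′ → ¬h (restrict h′)

¬all¬⇒∃ : {P : ℕ → Set} → (∀ i → Dec (P i)) → ∀ q → ¬ (∀ j → j < q → ¬ P j) → ∃ λ j → j < q × P j
¬all¬⇒∃ d zero nh = ⊥-elim (nh λ j ())
¬all¬⇒∃ {P} d (suc q) nh with d q
... | yes p = q , ≤-refl , p
... | no ¬p with ¬all¬⇒∃ d q (λ h → nh λ j j<1+q → below h (m≤n⇒m<n∨m≡n (≤-pred j<1+q)))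
  where
  below : (∀ j → j < q → ¬ P j) → ∀ {j} → j < q ⊎ j ≡ q → ¬ P j
  below h (inj₁ j<q)  = h _ j<q
  below h (inj₂ refl) = ¬p
...   | j , j<q , p = j , m<n⇒m<1+n j<q , p

least : {P : ℕ → Set} → (∀ i → Dec (P i)) → ∀ p → P p → ∃ λ m → m ≤ p × P m × (∀ j → j < m → ¬ P j)
least {P} d p pp = go p p ≤-refl pp
  where
  go : ∀ n p → p ≤ n → P p → ∃ λ m → m ≤ p × P m × (∀ j → j < m → ¬ P j)
  go n p p≤n pp with all<? (λ j → ¬? (d j)) p
  ... | yes h = p , ≤-refl , pp , h
  go zero p p≤n pp | no nh with ¬all¬⇒∃ d p nh
  ... | j , j<p , _ = ⊥-elim (<⇒≱ j<p (≤-trans p≤n z≤n))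
  go (suc n) p p≤n pp | no nh with ¬all¬⇒∃ d p nh
  ... | j , j<p , pj with go n j (≤-pred (≤-trans j<p p≤n)) pj
  ...   | m , m≤j , pm , h = m , ≤-trans m≤j (<⇒≤ j<p) , pm , h

greatest : {P : ℕ → Set} → (∀ i → Dec (P i)) → ∀ b p → p ≤ b → P p →
           ∃ λ m → p ≤ m × m ≤ b × P m × (∀ j → m < j → j ≤ b → ¬ P j)
greatest d zero zero z≤n pp = zero , z≤n , z≤n , pp , λ j lt le → ⊥-elim (<⇒≱ lt le)
greatest {P} d (suc b) p le pp with d (suc b)
... | yes q = suc b , le , ≤-refl , q , λ j lt le′ → ⊥-elim (<⇒≱ lt le′)
... | no ¬q with m≤n⇒m<n∨m≡n le
...   | inj₂ refl = ⊥-elim (¬q pp)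
...   | inj₁ p<1+b with greatest d b p (≤-pred p<1+b) pp
...     | m , p≤m , m≤b , pm , h = m , p≤m , m≤n⇒m≤1+n m≤b , pm , above
  where
  above : ∀ j → m < j → j ≤ suc b → ¬ P j
  above j lt le′ with m≤n⇒m<n∨m≡n le′
  ... | inj₁ j<1+b = h j lt (≤-pred j<1+b)
  ... | inj₂ refl  = ¬q

sumBelow : (ℕ → ℕ) → ℕ → ℕ
sumBelow f zero    = 0
sumBelow f (suc L) = sumBelow f L + f L

sumBelow-+ : ∀ f a b → sumBelow f (a + b) ≡ sumBelow f a + sumBelow (λ i → f (a + i)) b
sumBelow-+ f a zero    = trans (cong (sumBelow f) (+-identityʳ a)) (sym (+-identityʳ _))
sumBelow-+ f a (suc b) =
  trans (cong (sumBelow f) (+-suc a b)) (trans (cong (_+ f (a + b)) (sumBelow-+ f a b)) (+-assoc (sumBelow f a) _ _))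

sumBelow-zero : ∀ f L → (∀ i → i < L → f i ≡ 0) → sumBelow f L ≡ 0
sumBelow-zero f zero    h = refl
sumBelow-zero f (suc L) h = cong₂ _+_ (sumBelow-zero f L (restrict h)) (h L ≤-refl)

sumBelow-≥ : ∀ f L → (∀ i → i < L → 1 ≤ f i) → L ≤ sumBelow f L
sumBelow-≥ f zero    h = z≤n
sumBelow-≥ f (suc L) h = ≤-trans (≤-reflexive (+-comm 1 L)) (+-mono-≤ (sumBelow-≥ f L (restrict h)) (h L ≤-refl))

sumBelow-≤ : ∀ f L → (∀ i → i < L → f i ≤ 1) → sumBelow f L ≤ L
sumBelow-≤ f zero    h = z≤n
sumBelow-≤ f (suc L) h = ≤-trans (+-mono-≤ (sumBelow-≤ f L (restrict h)) (h L ≤-refl)) (≤-reflexive (+-comm L 1))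

sumBelow-all1 : ∀ f L → (∀ i → i < L → 1 ≤ f i) → sumBelow f L ≡ L → ∀ i → i < L → f i ≡ 1
sumBelow-all1 f (suc L) h e i i<1+L with m≤n⇒m<n∨m≡n (≤-pred i<1+L)
... | inj₁ i<L  = sumBelow-all1 f L (restrict h) (≤-antisym sum≤L (sumBelow-≥ f L (restrict h))) i i<L
  where
  sum≤L : sumBelow f L ≤ L
  sum≤L = ≤-pred (≤-trans (≤-reflexive (+-comm 1 _)) (≤-trans (+-monoʳ-≤ (sumBelow f L) (h L ≤-refl)) (≤-reflexive e)))
... | inj₂ refl = ≤-antisym fL≤1 (h L ≤-refl)
  where
  fL≤1 : f L ≤ 1
  fL≤1 = +-cancelˡ-≤ L (f L) 1
    (≤-trans (+-monoˡ-≤ (f L) (sumBelow-≥ f L (restrict h))) (≤-trans (≤-reflexive e) (≤-reflexive (+-comm 1 L))))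

<∸⇒+suc≤ : ∀ i n m → i < m ∸ n → i + suc n ≤ m
<∸⇒+suc≤ i n m lt = subst (_≤ m) (sym (+-suc i n)) (subst (suc i + n ≤_) (m∸n+n≡m n≤m) (+-monoˡ-≤ n lt))
  where
  n≤m : n ≤ m
  n≤m = ≮⇒≥ λ m<n → <⇒≱ (≤-trans (s≤s z≤n) lt) (≤-reflexive (m≤n⇒m∸n≡0 (<⇒≤ m<n)))

+suc≤⇒<∸ : ∀ i n m → i + suc n ≤ m → i < m ∸ n
+suc≤⇒<∸ i n m le = subst (_≤ m ∸ n) (m+n∸n≡m (suc i) n) (∸-monoˡ-≤ n (subst (_≤ m) (+-suc i n) le))

module _ {A : Set} where

  take-+ : ∀ m n (xs : List A) → take (m + n) xs ≡ take m xs ++ take n (drop m xs)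
  take-+ zero    n xs       = refl
  take-+ (suc m) zero []    = refl
  take-+ (suc m) (suc n) [] = refl
  take-+ (suc m) n (x ∷ xs) = cong (x ∷_) (take-+ m n xs)

  length-take-≤ : ∀ n (xs : List A) → n ≤ length xs → length (take n xs) ≡ n
  length-take-≤ n xs le = trans (length-take n xs) (m≤n⇒m⊓n≡m le)

  take-++ˡ : ∀ n (xs ys : List A) → n ≤ length xs → take n (xs ++ ys) ≡ take n xs
  take-++ˡ zero    xs       ys _         = refl
  take-++ˡ (suc n) (x ∷ xs) ys (s≤s le) = cong (x ∷_) (take-++ˡ n xs ys le)

  take-length-++ : ∀ (xs ys : List A) → take (length xs) (xs ++ ys) ≡ xs
  take-length-++ xs ys = trans (take-++ˡ (length xs) xs ys ≤-refl) (take-all (length xs) xs ≤-refl)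

  drop-++ʳ : ∀ i (xs ys : List A) → drop (length xs + i) (xs ++ ys) ≡ drop i ys
  drop-++ʳ i []       ys = refl
  drop-++ʳ i (x ∷ xs) ys = drop-++ʳ i xs ys

  drop-++ˡ : ∀ i (xs ys : List A) → i ≤ length xs → drop i (xs ++ ys) ≡ drop i xs ++ ys
  drop-++ˡ zero    xs       ys _         = refl
  drop-++ˡ (suc i) (x ∷ xs) ys (s≤s le) = drop-++ˡ i xs ys le

  ++-cancel-length : ∀ (xs xs′ ys ys′ : List A) → length xs ≡ length xs′ → xs ++ ys ≡ xs′ ++ ys′ →
                     xs ≡ xs′ × ys ≡ ys′
  ++-cancel-length []       []         ys ys′ _ e = refl , e
  ++-cancel-length (x ∷ xs) (x′ ∷ xs′) ys ys′ l e with ∷-injective e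
  ... | refl , e′ with ++-cancel-length xs xs′ ys ys′ (suc-injective l) e′
  ...   | refl , e″ = refl , e″

  ∷-injʳ-[] : ∀ {a b : A} → [ a ] ≡ [ b ] → a ≡ b
  ∷-injʳ-[] refl = refl

  -- The window of length n of w starting at position i (shorter near the end of w).
  window : List A → ℕ → ℕ → List A
  window w n i = take n (drop i w)

  window-+ : ∀ (w : List A) m n i → window w (m + n) i ≡ window w m i ++ window w n (i + m)
  window-+ w m n i = trans (take-+ m n (drop i w)) (cong (λ z → window w m i ++ take n z) (drop-drop i m w))

  window-length : ∀ (w : List A) n i → i + n ≤ length w → length (window w n i) ≡ n
  window-length w n i le = length-take-≤ n (drop i w)
    (subst (n ≤_) (sym (length-drop i w)) (subst (_≤ length w ∸ i) (m+n∸m≡n i n) (∸-monoˡ-≤ i le)))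

  take-window : ∀ (w : List A) m n i → m ≤ n → take m (window w n i) ≡ window w m i
  take-window w m n i le = trans (take-take m n (drop i w)) (cong (λ k → take k (drop i w)) (m≤n⇒m⊓n≡m le))

  window-prefix : ∀ (w : List A) m n i j → m ≤ n → window w n i ≡ window w n j → window w m i ≡ window w m j
  window-prefix w m n i j le e = trans (sym (take-window w m n i le)) (trans (cong (take m) e) (take-window w m n j le))

  window-suffix : ∀ (w : List A) m n i j → i + (m + n) ≤ length w → j + (m + n) ≤ length w →
                  window w (m + n) i ≡ window w (m + n) j → window w n (i + m) ≡ window w n (j + m)
  window-suffix w m n i j li lj e = proj₂ (++-cancel-length _ _ _ _
    (trans (window-length w m i (≤-trans (+-monoʳ-≤ i (m≤m+n m n)) li))
           (sym (window-length w m j (≤-trans (+-monoʳ-≤ j (m≤m+n m n)) lj))))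
    (trans (sym (window-+ w m n i)) (trans e (window-+ w m n j))))

  window-letter : ∀ (w : List A) i → i < length w → ∃ λ a → window w 1 i ≡ [ a ] × a ∈ w
  window-letter (x ∷ w) zero    _         = x , refl , here refl
  window-letter (x ∷ w) (suc i) (s≤s lt) with window-letter w i lt
  ... | a , e , a∈w = a , e , there a∈w

  window-++ˡ : ∀ (xs ys : List A) p → p < length xs → window (xs ++ ys) 1 p ≡ window xs 1 p
  window-++ˡ (x ∷ xs) ys zero    _         = refl
  window-++ˡ (x ∷ xs) ys (suc p) (s≤s lt) = window-++ˡ xs ys p lt

  window-++ʳ : ∀ (xs ys : List A) n q → window (xs ++ ys) n (length xs + q) ≡ window ys n q
  window-++ʳ xs ys n q = cong (take n) (drop-++ʳ q xs ys)

  factor⇒window : ∀ {u w : List A} → Factor u w → ∃ λ i → i + length u ≤ length w × window w (length u) i ≡ u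
  factor⇒window {u} (p , s , refl) = length p , length-bound , window-eq
    where
    length-bound : length p + length u ≤ length (p ++ u ++ s)
    length-bound = ≤-trans (+-monoʳ-≤ (length p) (m≤m+n (length u) (length s)))
      (≤-reflexive (sym (trans (length-++ p) (cong (length p +_) (length-++ u)))))
    window-eq : window (p ++ u ++ s) (length u) (length p) ≡ u
    window-eq = trans (cong (take (length u)) (trans (cong (λ z → drop z (p ++ u ++ s)) (sym (+-identityʳ (length p))))
                                                     (drop-++ʳ 0 p (u ++ s))))
                      (take-length-++ u s)

  window⇒factor : ∀ {u w : List A} i → window w (length u) i ≡ u → Factor u w
  window⇒factor {u} {w} i e = take i w , drop (length u) (drop i w) ,
    trans (cong (take i w ++_) (trans (cong (_++ drop (length u) (drop i w)) (sym e)) (take++drop≡id (length u) (drop i w))))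
          (take++drop≡id i w)

filter-applyUpTo : {X : Set} {P : Pred X 0ℓ} (P? : Decidable P) (f : ℕ → X) (k : ℕ) →
                   length (filter P? (applyUpTo f k)) ≡ count (λ i → P? (f i)) k
filter-applyUpTo P? f zero    = refl
filter-applyUpTo {P = P} P? f (suc k) = begin
  length (filter P? (applyUpTo f (suc k)))                         ≡⟨ cong (λ l → length (filter P? l)) (sym (applyUpTo-∷ʳ f k)) ⟩
  length (filter P? (applyUpTo f k ++ [ f k ]))                    ≡⟨ cong length (filter-++ P? (applyUpTo f k) [ f k ]) ⟩
  length (filter P? (applyUpTo f k) ++ filter P? [ f k ])          ≡⟨ length-++ (filter P? (applyUpTo f k)) ⟩
  length (filter P? (applyUpTo f k)) + length (filter P? [ f k ]) ≡⟨ cong₂ _+_ (filter-applyUpTo P? f k) (last (P? (f k))) ⟩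
  count (λ i → P? (f i)) k + ind (P? (f k))                        ∎
  where
  open ≡-Reasoning
  last : Dec (P (f k)) → length (filter P? [ f k ]) ≡ ind (P? (f k))
  last (yes p) = trans (cong length (filter-accept P? {f k} {[]} p)) (sym (ind-yes (P? (f k)) p))
  last (no ¬p) = trans (cong length (filter-reject P? {f k} {[]} ¬p)) (sym (ind-no (P? (f k)) ¬p))

module Distinct {X : Set} (_≟_ : DecidableEquality X) where

  open import Data.List.Membership.DecPropositional _≟_ using (_∈?_)

  distinct : List X → List X
  distinct = deduplicate _≟_

  distinct-∷ʳ-new : ∀ xs x → x ∉ xs → distinct (xs ++ [ x ]) ≡ distinct xs ++ [ x ]
  distinct-∷ʳ-new []       x _  = refl
  distinct-∷ʳ-new (y ∷ ys) x x∉ = cong (y ∷_) (begin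
    filter (λ z → ¬? (y ≟ z)) (distinct (ys ++ [ x ]))
      ≡⟨ cong (filter (λ z → ¬? (y ≟ z))) (distinct-∷ʳ-new ys x (λ m → x∉ (there m))) ⟩
    filter (λ z → ¬? (y ≟ z)) (distinct ys ++ [ x ])
      ≡⟨ filter-++ (λ z → ¬? (y ≟ z)) (distinct ys) [ x ] ⟩
    filter (λ z → ¬? (y ≟ z)) (distinct ys) ++ filter (λ z → ¬? (y ≟ z)) [ x ]
      ≡⟨ cong (filter (λ z → ¬? (y ≟ z)) (distinct ys) ++_) (filter-accept (λ z → ¬? (y ≟ z)) λ y≡x → x∉ (here (sym y≡x))) ⟩
    filter (λ z → ¬? (y ≟ z)) (distinct ys) ++ [ x ] ∎)
    where open ≡-Reasoning

  distinct-∷ʳ-old : ∀ xs x → x ∈ xs → distinct (xs ++ [ x ]) ≡ distinct xs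
  distinct-∷ʳ-old (y ∷ ys) x (there x∈) =
    cong (λ l → y ∷ filter (λ z → ¬? (y ≟ z)) l) (distinct-∷ʳ-old ys x x∈)
  distinct-∷ʳ-old (y ∷ ys) .y (here refl) with y ∈? ys
  ... | yes y∈ = cong (λ l → y ∷ filter (λ z → ¬? (y ≟ z)) l) (distinct-∷ʳ-old ys y y∈)
  ... | no y∉ = cong (y ∷_) (begin
    filter (λ z → ¬? (y ≟ z)) (distinct (ys ++ [ y ]))
      ≡⟨ cong (filter (λ z → ¬? (y ≟ z))) (distinct-∷ʳ-new ys y y∉) ⟩
    filter (λ z → ¬? (y ≟ z)) (distinct ys ++ [ y ])
      ≡⟨ filter-++ (λ z → ¬? (y ≟ z)) (distinct ys) [ y ] ⟩
    filter (λ z → ¬? (y ≟ z)) (distinct ys) ++ filter (λ z → ¬? (y ≟ z)) [ y ]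
      ≡⟨ cong (filter (λ z → ¬? (y ≟ z)) (distinct ys) ++_) (filter-reject (λ z → ¬? (y ≟ z)) λ y≢y → y≢y refl) ⟩
    filter (λ z → ¬? (y ≟ z)) (distinct ys) ++ []
      ≡⟨ ++-identityʳ _ ⟩
    filter (λ z → ¬? (y ≟ z)) (distinct ys) ∎)
    where
    open ≡-Reasoning

  FirstOcc : (ℕ → X) → ℕ → Set
  FirstOcc f i = ∀ j → j < i → ¬ (f j ≡ f i)

  firstOcc? : (f : ℕ → X) → ∀ i → Dec (FirstOcc f i)
  firstOcc? f i = all<? (λ j → ¬? (f j ≟ f i)) i

  distinct-applyUpTo : (f : ℕ → X) (k : ℕ) → length (distinct (applyUpTo f k)) ≡ count (firstOcc? f) k
  distinct-applyUpTo f zero    = refl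
  distinct-applyUpTo f (suc k) = begin
    length (distinct (applyUpTo f (suc k)))          ≡⟨ cong (λ l → length (distinct l)) (applyUpTo-∷ʳ f k) ⟨
    length (distinct (applyUpTo f k ++ [ f k ]))     ≡⟨ snoc (f k ∈? applyUpTo f k) ⟩
    count (firstOcc? f) k + ind (firstOcc? f k)      ∎
    where
    open ≡-Reasoning
    ih = distinct-applyUpTo f k
    old⇒¬first : f k ∈ applyUpTo f k → ¬ FirstOcc f k
    old⇒¬first m first with ∈-applyUpTo⁻ f m
    ... | j , j<k , e = first j j<k (sym e)
    ¬old⇒first : f k ∉ applyUpTo f k → FirstOcc f k
    ¬old⇒first ∉ j j<k e = ∉ (subst (_∈ applyUpTo f k) e (∈-applyUpTo⁺ f j<k))
    snoc : Dec (f k ∈ applyUpTo f k) →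
           length (distinct (applyUpTo f k ++ [ f k ])) ≡ count (firstOcc? f) k + ind (firstOcc? f k)
    snoc (yes m) = begin
      length (distinct (applyUpTo f k ++ [ f k ])) ≡⟨ cong length (distinct-∷ʳ-old _ _ m) ⟩
      length (distinct (applyUpTo f k))            ≡⟨ ih ⟩
      count (firstOcc? f) k                        ≡⟨ +-identityʳ _ ⟨
      count (firstOcc? f) k + 0                    ≡⟨ cong (count (firstOcc? f) k +_) (ind-no (firstOcc? f k) (old⇒¬first m)) ⟨
      count (firstOcc? f) k + ind (firstOcc? f k)  ∎
    snoc (no ∉) = begin
      length (distinct (applyUpTo f k ++ [ f k ])) ≡⟨ cong length (distinct-∷ʳ-new _ _ ∉) ⟩
      length (distinct (applyUpTo f k) ++ [ f k ]) ≡⟨ length-++ (distinct (applyUpTo f k)) ⟩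
      length (distinct (applyUpTo f k)) + 1        ≡⟨ cong₂ _+_ ih (sym (ind-yes (firstOcc? f k) (¬old⇒first ∉))) ⟩
      count (firstOcc? f) k + ind (firstOcc? f k)  ∎

filter-map : {X Y : Set} {P : Pred X 0ℓ} {Q : Pred Y 0ℓ} (P? : Decidable P) (Q? : Decidable Q) (g : Y → X) →
             (∀ y → (P (g y) → Q y) × (Q y → P (g y))) → ∀ ys → filter P? (map g ys) ≡ map g (filter Q? ys)
filter-map P? Q? g h []       = refl
filter-map {P = P} {Q} P? Q? g h (y ∷ ys) with P? (g y) | Q? y
... | yes p | yes q = cong (g y ∷_) (filter-map P? Q? g h ys)
... | yes p | no ¬q = ⊥-elim (¬q (proj₁ (h y) p))
... | no ¬p | yes q = ⊥-elim (¬p (proj₂ (h y) q))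
... | no ¬p | no ¬q = filter-map P? Q? g h ys

module Complexity {A : Set} (_≟_ : DecidableEquality A) where

  _≟L_ : DecidableEquality (List A)
  _≟L_ = _≟w_ _≟_

  open Distinct _≟L_ public
  module Letters = Distinct _≟_

  windows≡ : ∀ (n : ℕ) (w : List A) → windows _≟_ n w ≡ applyUpTo (window w n) (suc (length w) ∸ n)
  windows≡ zero    []       = refl
  windows≡ (suc n) []       = cong (applyUpTo (window [] (suc n))) (sym (0∸n≡0 n))
  windows≡ n       (x ∷ xs) with n ≤? suc (length xs)
  ... | yes le = trans (filter-accept (λ u → length u ≟ℕ n) {take n (x ∷ xs)} {map (take n) (suffixes xs)} (length-take-≤ n (x ∷ xs) le))
                       (trans (cong (take n (x ∷ xs) ∷_) (windows≡ n xs))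
                              (cong (applyUpTo (window (x ∷ xs) n)) (sym (+-∸-assoc 1 le))))
  ... | no ≰  = trans (filter-reject (λ u → length u ≟ℕ n) {take n (x ∷ xs)} {map (take n) (suffixes xs)} too-short)
                      (trans (windows≡ n xs)
                             (trans (cong (applyUpTo (window xs n)) (m≤n⇒m∸n≡0 (<⇒≤ (≰⇒> ≰))))
                                    (cong (applyUpTo (window (x ∷ xs) n)) (sym (m≤n⇒m∸n≡0 (≰⇒> ≰))))))
    where
    too-short : ¬ (length (take n (x ∷ xs)) ≡ n)
    too-short e = ≰ (subst (_≤ suc (length xs)) (trans (sym (length-take n (x ∷ xs))) e) (m⊓n≤n n (suc (length xs))))

  C≡count : ∀ (w : List A) (n : ℕ) → C _≟_ w n ≡ count (firstOcc? (window w n)) (suc (length w) ∸ n)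
  C≡count w n = trans (cong (λ l → length (distinct l)) (windows≡ n w)) (distinct-applyUpTo (window w n) (suc (length w) ∸ n))

  occ≡count : ∀ (u w : List A) → occ _≟_ u w ≡ count (λ i → u ≟L window w (length u) i) (suc (length w) ∸ length u)
  occ≡count u w = trans (cong (λ l → length (filter (u ≟L_) l)) (windows≡ (length u) w))
                        (filter-applyUpTo (u ≟L_) (window w (length u)) (suc (length w) ∸ length u))

  C-long : ∀ (w : List A) (n : ℕ) → length w < n → C _≟_ w n ≡ 0
  C-long w n lt = trans (C≡count w n) (cong (count (firstOcc? (window w n))) (m≤n⇒m∸n≡0 lt))

  C-zero : ∀ (w : List A) → C _≟_ w 0 ≡ 1
  C-zero w = trans (C≡count w 0) (trans (count-+ (firstOcc? (window w 0)) 1 (length w))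
                   (cong suc (count-none _ (length w) λ i _ first → first 0 (s≤s z≤n) refl)))

  windows-1 : ∀ (w : List A) → applyUpTo (window w 1) (length w) ≡ map [_] w
  windows-1 []       = refl
  windows-1 (x ∷ xs) = cong ([ x ] ∷_) (windows-1 xs)

  singleton-≟ : ∀ (a y : A) → ([ a ] ≡ [ y ] → a ≡ y) × (a ≡ y → [ a ] ≡ [ y ])
  singleton-≟ a y = ∷-injʳ-[] , cong [_]

  alph≡C1 : ∀ (w : List A) → alphSize _≟_ w ≡ C _≟_ w 1
  alph≡C1 w = sym (begin
    length (distinct (windows _≟_ 1 w))          ≡⟨ cong (λ l → length (distinct l)) (trans (windows≡ 1 w) (windows-1 w)) ⟩
    length (distinct (map [_] w))                ≡⟨ cong length (distinct-map w) ⟩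
    length (map [_] (Letters.distinct w))        ≡⟨ length-map [_] (Letters.distinct w) ⟩
    length (Letters.distinct w)                  ∎)
    where
    open ≡-Reasoning
    distinct-map : ∀ xs → distinct (map [_] xs) ≡ map [_] (Letters.distinct xs)
    distinct-map []       = refl
    distinct-map (x ∷ xs) = cong ([ x ] ∷_) (trans (cong (filter (λ z → ¬? ([ x ] ≟L z))) (distinct-map xs))
      (filter-map (λ z → ¬? ([ x ] ≟L z)) (λ z → ¬? (x ≟ z)) [_]
                  (λ y → (λ ne e → ne (cong [_] e)) , (λ ne e → ne (∷-injʳ-[] e))) (Letters.distinct xs)))

  alph≡count : ∀ (w : List A) → alphSize _≟_ w ≡ count (firstOcc? (window w 1)) (length w)
  alph≡count w = trans (alph≡C1 w) (C≡count w 1)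

  letterCount≡count : ∀ (a : A) (w : List A) →
                      length (filter (a ≟_) w) ≡ count (λ i → [ a ] ≟L window w 1 i) (length w)
  letterCount≡count a w = begin
    length (filter (a ≟_) w)                                ≡⟨ length-map [_] (filter (a ≟_) w) ⟨
    length (map [_] (filter (a ≟_) w))                      ≡⟨ cong length (filter-map ([ a ] ≟L_) (a ≟_) [_] (singleton-≟ a) w) ⟨
    length (filter ([ a ] ≟L_) (map [_] w))                 ≡⟨ cong (λ l → length (filter ([ a ] ≟L_) l)) (windows-1 w) ⟨
    length (filter ([ a ] ≟L_) (applyUpTo (window w 1) (length w))) ≡⟨ filter-applyUpTo ([ a ] ≟L_) (window w 1) (length w) ⟩
    count (λ i → [ a ] ≟L window w 1 i) (length w)          ∎
    where open ≡-Reasoning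

module Branching {A : Set} (_≟_ : DecidableEquality A) (v : List A) where

  open Complexity _≟_

  V : ℕ
  V = length v

  W : ℕ → ℕ → List A
  W n i = window v n i

  Cv : ℕ → ℕ
  Cv n = C _≟_ v n

  fits⇒< : ∀ i n → i + suc n ≤ V → i < V ∸ n
  fits⇒< i n = +suc≤⇒<∸ i n V

  <⇒fits : ∀ i n → i < V ∸ n → i + suc n ≤ V
  <⇒fits i n = <∸⇒+suc≤ i n V

  first-precedes : ∀ m f g → FirstOcc (W m) f → W m g ≡ W m f → ¬ g ≡ f → f < g
  first-precedes m f g first e g≢f with <-cmp f g
  ... | tri< f<g _ _ = f<g
  ... | tri≈ _ f≡g _ = ⊥-elim (g≢f (sym f≡g))
  ... | tri> _ _ g<f = ⊥-elim (first g g<f e)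

  firstOccurrence : ∀ m t → ∃ λ g → g ≤ t × W m g ≡ W m t × FirstOcc (W m) g
  firstOccurrence m t with least (λ j → W m j ≟L W m t) t refl
  ... | g , g≤t , eg , before = g , g≤t , eg , λ j j<g e → before j j<g (trans e eg)

  firstOcc-extend : ∀ n i → FirstOcc (W n) i → FirstOcc (W (suc n)) i
  firstOcc-extend n i first j j<i e = first j j<i (window-prefix v n (suc n) j i (n≤1+n n) e)

  Branch : ℕ → ℕ → Set
  Branch n i = FirstOcc (W (suc n)) i × ¬ FirstOcc (W n) i

  branch? : ∀ n i → Dec (Branch n i)
  branch? n i = firstOcc? (W (suc n)) i ×-dec ¬? (firstOcc? (W n) i)

  N : ℕ → ℕ
  N n = count (branch? n) (V ∸ n)

  SuffixUnique : ℕ → Set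
  SuffixUnique n = FirstOcc (W n) (V ∸ n)

  suffixUnique? : ∀ n → Dec (SuffixUnique n)
  suffixUnique? n = firstOcc? (W n) (V ∸ n)

  C-step : ∀ n → n ≤ V → Cv (suc n) + ind (suffixUnique? n) ≡ Cv n + N n
  C-step n le = begin
    Cv (suc n) + ind (suffixUnique? n)                 ≡⟨ cong (_+ ind (suffixUnique? n)) split ⟩
    count FO (V ∸ n) + N n + ind (suffixUnique? n)     ≡⟨ +-assoc (count FO (V ∸ n)) _ _ ⟩
    count FO (V ∸ n) + (N n + ind (suffixUnique? n))   ≡⟨ cong (count FO (V ∸ n) +_) (+-comm (N n) _) ⟩
    count FO (V ∸ n) + (ind (suffixUnique? n) + N n)   ≡⟨ +-assoc (count FO (V ∸ n)) _ _ ⟨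
    count FO (suc (V ∸ n)) + N n                       ≡⟨ cong (λ z → count FO z + N n) (+-∸-assoc 1 le) ⟨
    count FO (suc V ∸ n) + N n                         ≡⟨ cong (_+ N n) (C≡count v n) ⟨
    Cv n + N n                                         ∎
    where
    open ≡-Reasoning
    FO = firstOcc? (W n)
    split : Cv (suc n) ≡ count FO (V ∸ n) + N n
    split = trans (C≡count v (suc n)) (count-split FO (firstOcc? (W (suc n))) (V ∸ n) λ i _ → firstOcc-extend n i)

  suffix≡window : ∀ k → k ≤ V → suffixOfLength _≟_ k v ≡ W k (V ∸ k)
  suffix≡window k le = sym (take-all k (drop (V ∸ k) v) (≤-reflexive (trans (length-drop (V ∸ k) v) (m∸[m∸n]≡n le))))

  occ-suffix : ∀ k → k ≤ V → occ _≟_ (suffixOfLength _≟_ k v) v ≡ count (λ i → W k (V ∸ k) ≟L W k i) (V ∸ k) + 1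
  occ-suffix k le = begin
    occ _≟_ (suffixOfLength _≟_ k v) v                                  ≡⟨ occ≡count (suffixOfLength _≟_ k v) v ⟩
    count (λ i → suffixOfLength _≟_ k v ≟L W′ i) (suc V ∸ length (suffixOfLength _≟_ k v))
      ≡⟨ cong₂ (λ a b → count (λ i → a ≟L window v b i) (suc V ∸ b)) (suffix≡window k le) length-suffix ⟩
    count (λ i → W k (V ∸ k) ≟L W k i) (suc V ∸ k)                      ≡⟨ cong (count (λ i → W k (V ∸ k) ≟L W k i)) (+-∸-assoc 1 le) ⟩
    count (λ i → W k (V ∸ k) ≟L W k i) (V ∸ k) + ind (W k (V ∸ k) ≟L W k (V ∸ k))
      ≡⟨ cong (count (λ i → W k (V ∸ k) ≟L W k i) (V ∸ k) +_) (ind-yes (W k (V ∸ k) ≟L W k (V ∸ k)) refl) ⟩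
    count (λ i → W k (V ∸ k) ≟L W k i) (V ∸ k) + 1                      ∎
    where
    open ≡-Reasoning
    W′ = window v (length (suffixOfLength _≟_ k v))
    length-suffix : length (suffixOfLength _≟_ k v) ≡ k
    length-suffix = trans (length-drop (V ∸ k) v) (m∸[m∸n]≡n le)

  occ1⇔suffixUnique : ∀ k → k ≤ V →
    (occ _≟_ (suffixOfLength _≟_ k v) v ≡ 1 → SuffixUnique k) × (SuffixUnique k → occ _≟_ (suffixOfLength _≟_ k v) v ≡ 1)
  occ1⇔suffixUnique k le = once⇒unique , unique⇒once
    where
    once⇒unique : occ _≟_ (suffixOfLength _≟_ k v) v ≡ 1 → SuffixUnique k
    once⇒unique e j j<i eq =
      <⇒≢ (+-monoˡ-≤ 1 (∃⇒count≥1 (λ i → W k (V ∸ k) ≟L W k i) (V ∸ k) j j<i (sym eq))) (trans (sym e) (occ-suffix k le))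
    unique⇒once : SuffixUnique k → occ _≟_ (suffixOfLength _≟_ k v) v ≡ 1
    unique⇒once unique = trans (occ-suffix k le) (cong (_+ 1) (count-none _ (V ∸ k) λ i i< e → unique i i< (sym e)))

  suffixUnique-step : ∀ n → suc n ≤ V → SuffixUnique n → SuffixUnique (suc n)
  suffixUnique-step n le unique j j<i eq = unique (j + 1) j+1< shifted
    where
    V∸n : V ∸ suc n + 1 ≡ V ∸ n
    V∸n = trans (+-comm (V ∸ suc n) 1) (sym (+-∸-assoc 1 le))
    j+1< : j + 1 < V ∸ n
    j+1< = subst (_< V ∸ n) (+-comm 1 j) (subst (suc j <_) V∸n (≤-trans (s≤s j<i) (≤-reflexive (+-comm 1 _))))
    shifted : W n (j + 1) ≡ W n (V ∸ n)
    shifted = trans (window-suffix v 1 n j (V ∸ suc n) (≤-trans (+-monoʳ-≤ j (n≤1+n (suc n))) (<⇒fits j (suc n) j<i)) (≤-reflexive (m∸n+n≡m le)) eq)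
                    (cong (W n) V∸n)

  suffixUnique-mono : ∀ k d → k + d ≤ V → SuffixUnique k → SuffixUnique (k + d)
  suffixUnique-mono k zero    le unique = subst SuffixUnique (sym (+-identityʳ k)) unique
  suffixUnique-mono k (suc d) le unique = subst SuffixUnique (sym (+-suc k d))
    (suffixUnique-step (k + d) (subst (_≤ V) (+-suc k d) le) (suffixUnique-mono k d (≤-trans (+-monoʳ-≤ k (n≤1+n d)) le) unique))

  suffixUnique⇔K : ∀ K → IsK _≟_ v K → ∀ n → n ≤ V → (SuffixUnique n → K ≤ n) × (K ≤ n → SuffixUnique n)
  suffixUnique⇔K K (K≤V , occK , minK) n le =
    (λ unique → ≮⇒≥ λ n<K → minK n n<K (proj₂ (occ1⇔suffixUnique n le) unique)) ,
    λ K≤n → subst SuffixUnique (m+[n∸m]≡n K≤n)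
      (suffixUnique-mono K (n ∸ K) (≤-trans (≤-reflexive (m+[n∸m]≡n K≤n)) le) (proj₁ (occ1⇔suffixUnique K K≤V) occK))

  W-∷ʳ : ∀ n i → W (suc n) i ≡ W n i ++ W 1 (i + n)
  W-∷ʳ n i = subst (λ z → W z i ≡ W n i ++ W 1 (i + n)) (+-comm n 1) (window-+ v n 1 i)

  -- Two positions whose n-windows agree while their (n+1)-windows differ; the common
  -- n-window is then a right special factor, and every right special factor arises so.
  RSPair : ℕ → ℕ → ℕ → Set
  RSPair n i j = i + suc n ≤ V × j + suc n ≤ V × W n i ≡ W n j × ¬ (W (suc n) i ≡ W (suc n) j)

  rsPair⇒rightSpecial : ∀ n i j → RSPair n i j → RightSpecial _≟_ (W n i) v
  rsPair⇒rightSpecial n i j (ri , rj , e , ne)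
    with window-letter v (i + n) (subst (_≤ V) (+-suc i n) ri) | window-letter v (j + n) (subst (_≤ V) (+-suc j n) rj)
  ... | x , ex , _ | y , ey , _ =
    x , y , (λ x≡y → ne (trans (W-∷ʳ n i) (trans (cong₂ _++_ e (trans ex (trans (cong [_] x≡y) (sym ey)))) (sym (W-∷ʳ n j))))) ,
    window⇒factor i (extension i x refl ex) , window⇒factor j (extension j y (sym e) ey)
    where
    extension : ∀ t z → W n t ≡ W n i → W 1 (t + n) ≡ [ z ] → window v (length (W n i ++ [ z ])) t ≡ W n i ++ [ z ]
    extension t z et ez = trans (cong (λ m → window v m t) length-ext) (trans (W-∷ʳ n t) (cong₂ _++_ et ez))
      where
      length-ext : length (W n i ++ [ z ]) ≡ suc n
      length-ext = trans (length-++ (W n i)) (trans (cong (_+ 1) (window-length v n i (≤-trans (+-monoʳ-≤ i (n≤1+n n)) ri))) (+-comm n 1))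

  rightSpecial⇒rsPair : ∀ n (u : List A) → length u ≡ n → RightSpecial _≟_ u v → ∃₂ λ i j → RSPair n i j × W n i ≡ u
  rightSpecial⇒rsPair n u lu (x , y , x≢y , fx , fy) with factor⇒window fx | factor⇒window fy
  ... | i , ri , ei | j , rj , ej =
    i , j , (fits i x ri , fits j y rj , trans (prefix i x ei) (sym (prefix j y ej)) ,
             λ e → x≢y (last-letter (trans (sym (whole i x ei)) (trans e (whole j y ej))))) ,
    prefix i x ei
    where
    length-ext : ∀ z → length (u ++ [ z ]) ≡ suc n
    length-ext z = trans (length-++ u) (trans (cong (_+ 1) lu) (+-comm n 1))
    fits : ∀ k z → k + length (u ++ [ z ]) ≤ V → k + suc n ≤ V
    fits k z = subst (_≤ V) (cong (k +_) (length-ext z))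
    whole : ∀ k z → window v (length (u ++ [ z ])) k ≡ u ++ [ z ] → W (suc n) k ≡ u ++ [ z ]
    whole k z e = trans (cong (λ m → window v m k) (sym (length-ext z))) e
    prefix : ∀ k z → window v (length (u ++ [ z ])) k ≡ u ++ [ z ] → W n k ≡ u
    prefix k z e = trans (sym (take-window v n (suc n) k (n≤1+n n)))
      (trans (cong (take n) (whole k z e)) (subst (λ m → take m (u ++ [ z ]) ≡ u) lu (take-length-++ u [ z ])))
    last-letter : u ++ [ x ] ≡ u ++ [ y ] → x ≡ y
    last-letter e = ∷-injʳ-[] (++-cancelˡ u [ x ] [ y ] e)

  two-branchings : ∀ n g₁ g₂ → ¬ g₁ ≡ g₂ → g₁ < V ∸ n → g₂ < V ∸ n → Branch n g₁ → Branch n g₂ → 2 ≤ N n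
  two-branchings n g₁ g₂ g₁≢g₂ l₁ l₂ b₁ b₂ with <-cmp g₁ g₂
  ... | tri< g₁<g₂ _ _ = ∃₂⇒count≥2 (branch? n) (V ∸ n) g₁ g₂ g₁<g₂ l₂ b₁ b₂
  ... | tri≈ _ g₁≡g₂ _ = ⊥-elim (g₁≢g₂ g₁≡g₂)
  ... | tri> _ _ g₂<g₁ = ∃₂⇒count≥2 (branch? n) (V ∸ n) g₂ g₁ g₂<g₁ l₁ b₂ b₁

  extension⇒branch : ∀ n f t → FirstOcc (W n) f → W n t ≡ W n f → t + suc n ≤ V → ¬ W (suc n) t ≡ W (suc n) f →
                     ∃ λ g → g < V ∸ n × Branch n g × W (suc n) g ≡ W (suc n) t
  extension⇒branch n f t first-f e rt ne with firstOccurrence (suc n) t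
  ... | g , g≤t , eg , first-g = g , ≤-trans (s≤s g≤t) (fits⇒< t n rt) , (first-g , λ fo → fo f f<g (sym eg-f)) , eg
    where
    eg-f : W n g ≡ W n f
    eg-f = trans (window-prefix v n (suc n) g t (n≤1+n n) eg) e
    f<g : f < g
    f<g = first-precedes n f g first-f eg-f λ { refl → ne (sym eg) }

  branch⇒earlier : ∀ n i → Branch n i → ∃ λ j → j < i × W n j ≡ W n i × ¬ W (suc n) j ≡ W (suc n) i
  branch⇒earlier n i (first , ¬first) with ¬all¬⇒∃ (λ j → W n j ≟L W n i) i ¬first
  ... | j , j<i , e = j , j<i , e , first j j<i

  branching⇒rsPair : ∀ n → 1 ≤ N n → ∃₂ λ i j → RSPair n i j
  branching⇒rsPair n h with count≥1⇒∃ (branch? n) (V ∸ n) h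
  ... | g , g< , bg with branch⇒earlier n g bg
  ...   | j , j<g , e , ne = j , g , <⇒fits j n (<-trans j<g g<) , <⇒fits g n g< , e , ne

  rsPair⇒branching : ∀ n p q → RSPair n p q → ∃ λ g → g < V ∸ n × Branch n g × W n g ≡ W n p
  rsPair⇒branching n p q (rp , rq , e , ne) with firstOccurrence n p
  ... | f , _ , ef , first-f with W (suc n) p ≟L W (suc n) f
  ...   | no ne-p = from p rp ef ne-p
    where
    from : ∀ t → t + suc n ≤ V → W n f ≡ W n t → ¬ W (suc n) t ≡ W (suc n) f → ∃ λ g → g < V ∸ n × Branch n g × W n g ≡ W n p
    from t rt eft net with extension⇒branch n f t first-f (sym eft) rt net
    ... | g , lg , bg , eg = g , lg , bg , trans (window-prefix v n (suc n) g t (n≤1+n n) eg) (trans (sym eft) ef)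
  ...   | yes e-p with extension⇒branch n f q first-f (trans (sym e) (sym ef)) rq (λ e-q → ne (trans e-p (sym e-q)))
  ...     | g , lg , bg , eg = g , lg , bg , trans (window-prefix v n (suc n) g q (n≤1+n n) eg) (sym e)

  distinct-rsPairs⇒N≥2 : ∀ n p q p′ q′ → RSPair n p q → RSPair n p′ q′ → ¬ W n p ≡ W n p′ → 2 ≤ N n
  distinct-rsPairs⇒N≥2 n p q p′ q′ rs rs′ ne with rsPair⇒branching n p q rs | rsPair⇒branching n p′ q′ rs′
  ... | g , lg , bg , eg | g′ , lg′ , bg′ , eg′ = two-branchings n g g′ (λ { refl → ne (trans (sym eg) eg′) }) lg lg′ bg bg′

  two-extensions⇒N≥2 : ∀ n f s t → FirstOcc (W n) f → s + suc n ≤ V → t + suc n ≤ V → W n s ≡ W n f → W n t ≡ W n f →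
    ¬ W (suc n) s ≡ W (suc n) t → ¬ W (suc n) s ≡ W (suc n) f → ¬ W (suc n) t ≡ W (suc n) f → 2 ≤ N n
  two-extensions⇒N≥2 n f s t first-f rs rt es et nst ns nt
    with extension⇒branch n f s first-f es rs ns | extension⇒branch n f t first-f et rt nt
  ... | g , lg , bg , eg | g′ , lg′ , bg′ , eg′ = two-branchings n g g′ (λ { refl → nst (trans (sym eg) eg′) }) lg lg′ bg bg′

  three-extensions⇒N≥2 : ∀ n a b c → a + suc n ≤ V → b + suc n ≤ V → c + suc n ≤ V → W n a ≡ W n b → W n a ≡ W n c →
    ¬ W (suc n) a ≡ W (suc n) b → ¬ W (suc n) a ≡ W (suc n) c → ¬ W (suc n) b ≡ W (suc n) c → 2 ≤ N n
  three-extensions⇒N≥2 n a b c ra rb rc eab eac nab nac nbc with firstOccurrence n a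
  ... | f , _ , ef , first-f with W (suc n) a ≟L W (suc n) f | W (suc n) b ≟L W (suc n) f
  ...   | no na | no nb  = two-extensions⇒N≥2 n f a b first-f ra rb (sym ef) (trans (sym eab) (sym ef)) nab na nb
  ...   | yes ea | _     = two-extensions⇒N≥2 n f b c first-f rb rc (trans (sym eab) (sym ef)) (trans (sym eac) (sym ef)) nbc
                             (λ eb → nab (trans ea (sym eb))) (λ ec → nac (trans ea (sym ec)))
  ...   | no na | yes eb = two-extensions⇒N≥2 n f a c first-f ra rc (sym ef) (trans (sym eac) (sym ef)) nac na
                             (λ ec → nbc (trans eb (sym ec)))

  rsPair-suffix : ∀ m d i j → RSPair (d + m) i j → RSPair m (i + d) (j + d)
  rsPair-suffix m d i j (ri , rj , e , ne) = shift ri , shift rj , window-suffix v d m i j (short ri) (short rj) e , ne′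
    where
    shift : ∀ {k} → k + suc (d + m) ≤ V → k + d + suc m ≤ V
    shift {k} = subst (_≤ V) (trans (cong (k +_) (sym (+-suc d m))) (sym (+-assoc k d (suc m))))
    short : ∀ {k} → k + suc (d + m) ≤ V → k + (d + m) ≤ V
    short {k} = ≤-trans (+-monoʳ-≤ k (n≤1+n (d + m)))
    split : ∀ k → W (suc (d + m)) k ≡ W d k ++ W (suc m) (k + d)
    split k = subst (λ z → W z k ≡ W d k ++ W (suc m) (k + d)) (+-suc d m) (window-+ v d (suc m) k)
    ne′ : ¬ W (suc m) (i + d) ≡ W (suc m) (j + d)
    ne′ e′ = ne (trans (split i) (trans (cong₂ _++_ (window-prefix v d (d + m) i j (m≤m+n d m) e) e′) (sym (split j))))

  N-zero : ∀ R → IsR _≟_ v R → ∀ n → R ≤ n → N n ≡ 0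
  N-zero R (_ , none , _) n R≤n with N n in eqN
  ... | zero  = refl
  ... | suc _ with branching⇒rsPair n (subst (1 ≤_) (sym eqN) (s≤s z≤n))
  ...   | i , j , rs = ⊥-elim (none (W R (i + d)) (window-length v R (i + d) (≤-trans (+-monoʳ-≤ _ (n≤1+n R)) (proj₁ rs′)))
                                    (rsPair⇒rightSpecial R (i + d) (j + d) rs′))
    where
    d = n ∸ R
    rs′ : RSPair R (i + d) (j + d)
    rs′ = rsPair-suffix R d i j (subst (λ z → RSPair z i j) (sym (m∸n+n≡m R≤n)) rs)

  N-positive : ∀ R → IsR _≟_ v R → ∀ n → 1 ≤ n → n < R → 1 ≤ N n
  N-positive R (_ , _ , some) n 1≤n n<R with some n 1≤n n<R
  ... | u , lu , rs with rightSpecial⇒rsPair n u lu rs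
  ...   | i , j , rp , _ with rsPair⇒branching n i j rp
  ...     | g , lg , bg , _ = ∃⇒count≥1 (branch? n) (V ∸ n) g lg bg

  rightSpecial⇒alph≥2 : ∀ u → RightSpecial _≟_ u v → 2 ≤ alphSize _≟_ v
  rightSpecial⇒alph≥2 u (x , y , x≢y , (p , s , ex) , (p′ , s′ , ey)) =
    two-members (Letters.distinct v) (∈-deduplicate⁺ _≟_ (occurs x p s ex)) (∈-deduplicate⁺ _≟_ (occurs y p′ s′ ey)) x≢y
    where
    occurs : ∀ z p s → p ++ (u ++ [ z ]) ++ s ≡ v → z ∈ v
    occurs z p s e = subst (z ∈_) e (∈-++⁺ʳ p (∈-++⁺ˡ (∈-++⁺ʳ u (here refl))))
    two-members : {X : Set} {x y : X} (l : List X) → x ∈ l → y ∈ l → ¬ x ≡ y → 2 ≤ length l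
    two-members (a ∷ l)     (here refl) (here refl) ne = ⊥-elim (ne refl)
    two-members (a ∷ [])    (here refl) (there ())  ne
    two-members (a ∷ b ∷ l) _           _           ne = s≤s (s≤s z≤n)
    two-members (a ∷ [])    (there ())  _           ne

  -- Two branching
  -- points at length K shift to right special pairs at length k; since these all share one
  -- k-window u₀ with at most two extensions, either three extensions of u₀ appear, or every
  -- occurrence of u₀ has a K-window occurring twice, and following the last occurrence of u₀
  -- to the end of v shows that the suffix of length K occurs twice.
  module OneBranching (k : ℕ) (K≤V : suc k ≤ V) (unique : SuffixUnique (suc k)) (N≤1 : N k ≤ 1) where

    K : ℕ
    K = suc k

    E : ℕ
    E = V ∸ K

    ≤E⇒fits : ∀ q → q ≤ E → q + K ≤ V
    ≤E⇒fits q le = subst (q + K ≤_) (m∸n+n≡m K≤V) (+-monoˡ-≤ K le)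

    fits⇒≤E : ∀ q → q + K ≤ V → q ≤ E
    fits⇒≤E q le = subst (_≤ E) (m+n∸n≡m q K) (∸-monoˡ-≤ K le)

    not-two : ¬ (2 ≤ N k)
    not-two h = <⇒≱ h N≤1

    special-unique : ∀ a b a′ b′ → RSPair k a b → RSPair k a′ b′ → W k a ≡ W k a′
    special-unique a b a′ b′ r r′ with W k a ≟L W k a′
    ... | yes e = e
    ... | no ne = ⊥-elim (not-two (distinct-rsPairs⇒N≥2 k a b a′ b′ r r′ ne))

    at-most-two : ∀ a b x → RSPair k a b → W k x ≡ W k a → x + K ≤ V → W K x ≡ W K a ⊎ W K x ≡ W K b
    at-most-two a b x (ra , rb , eab , nab) exa rx with W K x ≟L W K a | W K x ≟L W K b
    ... | yes ea | _     = inj₁ ea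
    ... | no _   | yes eb = inj₂ eb
    ... | no na  | no nb  = ⊥-elim (not-two (three-extensions⇒N≥2 k a b x ra rb rx eab (sym exa) nab
                                                (λ e → na (sym e)) (λ e → nb (sym e))))

    shift : ∀ j i → j < i → i < E → W K j ≡ W K i → ¬ W (suc K) j ≡ W (suc K) i → RSPair k (j + 1) (i + 1)
    shift j i j<i i<E e ne = rsPair-suffix k 1 j i (<⇒fits j K (<-trans j<i i<E) , <⇒fits i K i<E , e , ne)

    -- Let Q be the last occurrence of the right special k-window of the pair (a , b).  An
    -- earlier occurrence q of the K-window at Q stays in step with Q up to the end of v,
    -- so the suffix of length K would occur twice.
    no-earlier-twin : ∀ a b Q q → RSPair k a b → Q ≤ E → (∀ j → Q < j → j ≤ E → ¬ W k j ≡ W k a) →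
                      q < Q → W K q ≡ W K Q → ⊥
    no-earlier-twin a b Q q rab Q≤E last q<Q eq =
      unique (q + d) (subst (q + d <_) Q+d≡E (+-monoˡ-< d q<Q)) (trans (in-step d (≤-reflexive Q+d≡E)) (cong (W K) Q+d≡E))
      where
      d = E ∸ Q
      Q+d≡E : Q + d ≡ E
      Q+d≡E = m+[n∸m]≡n Q≤E
      +1≡suc : ∀ x y → x + y + 1 ≡ x + suc y
      +1≡suc x y = trans (+-assoc x y 1) (cong (x +_) (+-comm y 1))
      in-step : ∀ d → Q + d ≤ E → W K (q + d) ≡ W K (Q + d)
      in-step zero    _  = subst₂ (λ x y → W K x ≡ W K y) (sym (+-identityʳ q)) (sym (+-identityʳ Q)) eq
      in-step (suc d) le with W K (q + d + 1) ≟L W K (Q + d + 1)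
      ... | yes e = subst₂ (λ x y → W K x ≡ W K y) (+1≡suc q d) (+1≡suc Q d) e
      ... | no ne = ⊥-elim (last (Q + d + 1) Q<Q+d+1 Q+d+1≤E (special-unique (Q + d + 1) (q + d + 1) a b pair rab))
        where
        Q+d+1≤E : Q + d + 1 ≤ E
        Q+d+1≤E = subst (_≤ E) (sym (+1≡suc Q d)) le
        Q<Q+d+1 : Q < Q + d + 1
        Q<Q+d+1 = ≤-trans (≤-reflexive (+-comm 1 Q)) (+-monoˡ-≤ 1 (m≤m+n Q d))
        q+d+1≤E : q + d + 1 ≤ E
        q+d+1≤E = ≤-trans (+-monoˡ-≤ 1 (+-monoˡ-≤ d (<⇒≤ q<Q))) Q+d+1≤E
        Q+d≤E : Q + d ≤ E
        Q+d≤E = ≤-trans (m≤m+n (Q + d) 1) Q+d+1≤E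
        q+d≤E : q + d ≤ E
        q+d≤E = ≤-trans (m≤m+n (q + d) 1) q+d+1≤E
        pair : RSPair k (Q + d + 1) (q + d + 1)
        pair = ≤E⇒fits _ Q+d+1≤E , ≤E⇒fits _ q+d+1≤E ,
               sym (window-suffix v 1 k (q + d) (Q + d) (≤E⇒fits _ q+d≤E) (≤E⇒fits _ Q+d≤E) (in-step d Q+d≤E)) ,
               λ e → ne (sym e)

    twin : ∀ a₁ b₁ a₂ b₂ → RSPair k (a₁ + 1) (b₁ + 1) → RSPair k (a₂ + 1) (b₂ + 1) →
           (∀ x y → x ≡ a₁ ⊎ x ≡ b₁ → y ≡ a₂ ⊎ y ≡ b₂ → ¬ x ≡ y) →
           ∀ Q → Q + K ≤ V → W k Q ≡ W k (a₁ + 1) → ∃ λ q → ¬ q ≡ Q × q + K ≤ V × W K q ≡ W K Q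
    twin a₁ b₁ a₂ b₂ r₁ r₂ apart Q rQ eQ =
      combine (at-most-two (a₁ + 1) (b₁ + 1) Q r₁ eQ rQ)
              (at-most-two (a₂ + 1) (b₂ + 1) Q r₂ (trans eQ (special-unique _ _ _ _ r₁ r₂)) rQ)
      where
      Twin : Set
      Twin = ∃ λ q → ¬ q ≡ Q × q + K ≤ V × W K q ≡ W K Q
      pick : ∀ x y → x ≡ a₁ ⊎ x ≡ b₁ → y ≡ a₂ ⊎ y ≡ b₂ → x + 1 + K ≤ V → y + 1 + K ≤ V →
             W K Q ≡ W K (x + 1) → W K Q ≡ W K (y + 1) → Twin
      pick x y mx my rx ry ex ey with x + 1 ≟ℕ Q
      ... | no ne    = x + 1 , ne , rx , sym ex
      ... | yes refl = y + 1 , (λ e → apart x y mx my (sym (+-cancelʳ-≡ 1 y x e))) , ry , sym ey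
      combine : W K Q ≡ W K (a₁ + 1) ⊎ W K Q ≡ W K (b₁ + 1) → W K Q ≡ W K (a₂ + 1) ⊎ W K Q ≡ W K (b₂ + 1) → Twin
      combine (inj₁ e₁) (inj₁ e₂) = pick a₁ a₂ (inj₁ refl) (inj₁ refl) (proj₁ r₁) (proj₁ r₂) e₁ e₂
      combine (inj₁ e₁) (inj₂ e₂) = pick a₁ b₂ (inj₁ refl) (inj₂ refl) (proj₁ r₁) (proj₁ (proj₂ r₂)) e₁ e₂
      combine (inj₂ e₁) (inj₁ e₂) = pick b₁ a₂ (inj₂ refl) (inj₁ refl) (proj₁ (proj₂ r₁)) (proj₁ r₂) e₁ e₂
      combine (inj₂ e₁) (inj₂ e₂) = pick b₁ b₂ (inj₂ refl) (inj₂ refl) (proj₁ (proj₂ r₁)) (proj₁ (proj₂ r₂)) e₁ e₂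

    equal-windows⇒⊥ : ∀ j₁ i₁ i₂ → j₁ < i₁ → i₁ < i₂ → i₂ < E → W K j₁ ≡ W K i₁ → ¬ W (suc K) j₁ ≡ W (suc K) i₁ →
                      FirstOcc (W (suc K)) i₂ → W K i₁ ≡ W K i₂ → ⊥
    equal-windows⇒⊥ j₁ i₁ i₂ j₁<i₁ i₁<i₂ i₂<E e₁ ne₁ first₂ e₁₂ =
      not-two (three-extensions⇒N≥2 k (j₁ + 1) (i₁ + 1) (i₂ + 1)
                (proj₁ r₁) (proj₁ (proj₂ r₁)) (proj₁ (proj₂ r₁₂))
                (proj₁ (proj₂ (proj₂ r₁))) (proj₁ (proj₂ (proj₂ r₀₂)))
                (proj₂ (proj₂ (proj₂ r₁))) (proj₂ (proj₂ (proj₂ r₀₂))) (proj₂ (proj₂ (proj₂ r₁₂))))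
      where
      j₁<i₂ = <-trans j₁<i₁ i₁<i₂
      r₁  = shift j₁ i₁ j₁<i₁ (<-trans i₁<i₂ i₂<E) e₁ ne₁
      r₁₂ = shift i₁ i₂ i₁<i₂ i₂<E e₁₂ (first₂ i₁ i₁<i₂)
      r₀₂ = shift j₁ i₂ j₁<i₂ i₂<E (trans e₁ e₁₂) (first₂ j₁ j₁<i₂)

    -- Two right special pairs at length k shifted from positions with different K-windows: the
    -- last occurrence of the special k-window has an earlier twin, which is impossible.
    different-windows⇒⊥ : ∀ a₁ b₁ a₂ b₂ → RSPair k (a₁ + 1) (b₁ + 1) → RSPair k (a₂ + 1) (b₂ + 1) →
                          (∀ x y → x ≡ a₁ ⊎ x ≡ b₁ → y ≡ a₂ ⊎ y ≡ b₂ → ¬ x ≡ y) → ⊥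
    different-windows⇒⊥ a₁ b₁ a₂ b₂ r₁ r₂ apart
      with greatest (λ q → W k q ≟L W k (a₁ + 1)) E (a₁ + 1) (fits⇒≤E (a₁ + 1) (proj₁ r₁)) refl
    ... | Q , _ , Q≤E , eQ , last with twin a₁ b₁ a₂ b₂ r₁ r₂ apart Q (≤E⇒fits Q Q≤E) eQ
    ...   | q , q≢Q , rq , eq = no-earlier-twin (a₁ + 1) (b₁ + 1) Q q r₁ Q≤E last q<Q eq
      where
      q<Q : q < Q
      q<Q with <-cmp q Q
      ... | tri< q<Q _ _ = q<Q
      ... | tri≈ _ q≡Q _ = ⊥-elim (q≢Q q≡Q)
      ... | tri> _ _ Q<q = ⊥-elim (last q Q<q (fits⇒≤E q rq) (trans (window-prefix v k K q Q (n≤1+n k) eq) eQ))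

    at-most-one : ¬ (2 ≤ N K)
    at-most-one h with count≥2⇒∃₂ (branch? K) E h
    ... | i₁ , i₂ , i₁<i₂ , i₂<E , b₁ , b₂ with branch⇒earlier K i₁ b₁ | branch⇒earlier K i₂ b₂
    ... | j₁ , j₁<i₁ , e₁ , ne₁ | j₂ , j₂<i₂ , e₂ , ne₂ with W K i₁ ≟L W K i₂
    ...   | yes e₁₂ = equal-windows⇒⊥ j₁ i₁ i₂ j₁<i₁ i₁<i₂ i₂<E e₁ ne₁ (proj₁ b₂) e₁₂
    ...   | no n₁₂  = different-windows⇒⊥ j₁ i₁ j₂ i₂ (shift j₁ i₁ j₁<i₁ (<-trans i₁<i₂ i₂<E) e₁ ne₁)
                                         (shift j₂ i₂ j₂<i₂ i₂<E e₂ ne₂) apart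
      where
      window-at₁ : ∀ {x} → x ≡ j₁ ⊎ x ≡ i₁ → W K x ≡ W K i₁
      window-at₁ (inj₁ refl) = e₁
      window-at₁ (inj₂ refl) = refl
      window-at₂ : ∀ {y} → y ≡ j₂ ⊎ y ≡ i₂ → W K y ≡ W K i₂
      window-at₂ (inj₁ refl) = e₂
      window-at₂ (inj₂ refl) = refl
      apart : ∀ x y → x ≡ j₁ ⊎ x ≡ i₁ → y ≡ j₂ ⊎ y ≡ i₂ → ¬ x ≡ y
      apart x y mx my x≡y = n₁₂ (trans (sym (window-at₁ mx)) (trans (cong (W K) x≡y) (window-at₂ my)))

  -- The balance identity |Alph(v)| + Σ_{1 ≤ n < R} N(n) + K = |v| + 1, obtained by summing
  -- C-step over 1 ≤ n ≤ |v|: the unique-suffix correction is 1 exactly for K ≤ n, and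
  -- no position branches at lengths n ≥ R.
  module Thresholds (R K : ℕ) (isR : IsR _≟_ v R) (isK : IsK _≟_ v K) (v≢[] : 1 ≤ V) where

    K≤V : K ≤ V
    K≤V = proj₁ isK

    K≥1 : 1 ≤ K
    K≥1 = ≰⇒> λ K≤0 → proj₂ (suffixUnique⇔K K isK 0 z≤n) K≤0 0 v≢[] refl

    R≥1 : 1 ≤ R
    R≥1 = proj₁ isR

    R≤V : R ≤ V
    R≤V = ≮⇒≥ λ V<R → <⇒≱ (≤-trans (N-positive R isR V v≢[] V<R) (≤-reflexive (cong (count (branch? V)) (n∸n≡0 V)))) z≤n

    C-step-K : ∀ n → n ≤ V → Cv (suc n) + ind (K ≤? n) ≡ Cv n + N n
    C-step-K n le = trans (cong (Cv (suc n) +_) (ind-cong (K ≤? n) (suffixUnique? n) (proj₂ (suffixUnique⇔K K isK n le))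
                                                                                  (proj₁ (suffixUnique⇔K K isK n le))))
                          (C-step n le)

    Nsum : ℕ → ℕ
    Nsum = sumBelow (λ i → N (suc i))

    telescope : ∀ L → L ≤ V → Cv (suc L) + count (λ n → K ≤? suc n) L ≡ Cv 1 + Nsum L
    telescope zero    _  = refl
    telescope (suc L) le = begin
      Cv (suc (suc L)) + (count (λ n → K ≤? suc n) L + ind (K ≤? suc L)) ≡⟨ x∙yz≈y∙xz (Cv (suc (suc L))) (count (λ n → K ≤? suc n) L) (ind (K ≤? suc L)) ⟩
      count (λ n → K ≤? suc n) L + (Cv (suc (suc L)) + ind (K ≤? suc L)) ≡⟨ cong (count (λ n → K ≤? suc n) L +_) (C-step-K (suc L) le) ⟩
      count (λ n → K ≤? suc n) L + (Cv (suc L) + N (suc L))              ≡⟨ x∙yz≈y∙xz (count (λ n → K ≤? suc n) L) (Cv (suc L)) (N (suc L)) ⟩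
      Cv (suc L) + (count (λ n → K ≤? suc n) L + N (suc L))              ≡⟨ +-assoc (Cv (suc L)) _ _ ⟨
      Cv (suc L) + count (λ n → K ≤? suc n) L + N (suc L)                ≡⟨ cong (_+ N (suc L)) (telescope L (≤-trans (n≤1+n L) le)) ⟩
      Cv 1 + Nsum L + N (suc L)                                          ≡⟨ +-assoc (Cv 1) _ _ ⟩
      Cv 1 + Nsum (suc L)                                                ∎
      where open ≡-Reasoning

    unique-suffixes : count (λ n → K ≤? suc n) V + K ≡ suc V
    unique-suffixes = begin
      count K≤1+ V + K                                      ≡⟨ cong (λ z → count K≤1+ z + K) (m+[n∸m]≡n k≤V) ⟨
      count K≤1+ (k + (V ∸ k)) + K                          ≡⟨ cong (_+ K) (count-+ K≤1+ k (V ∸ k)) ⟩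
      count K≤1+ k + count (λ i → K ≤? suc (k + i)) (V ∸ k) + K
        ≡⟨ cong₂ (λ a b → a + b + K) (count-none K≤1+ k λ i i<k le → <⇒≱ (≤-trans (s≤s i<k) (≤-reflexive (sym K≡1+k))) le)
                                     (count-all _ (V ∸ k) λ i _ → ≤-trans (≤-reflexive K≡1+k) (s≤s (m≤m+n k i))) ⟩
      V ∸ k + K                                             ≡⟨ cong (V ∸ k +_) K≡1+k ⟩
      V ∸ k + suc k                                         ≡⟨ +-suc (V ∸ k) k ⟩
      suc (V ∸ k + k)                                       ≡⟨ cong suc (m∸n+n≡m k≤V) ⟩
      suc V                                                 ∎
      where
      open ≡-Reasoning
      K≤1+ = λ n → K ≤? suc n
      k = K ∸ 1
      K≡1+k : K ≡ suc k
      K≡1+k = sym (trans (+-comm 1 k) (m∸n+n≡m K≥1))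
      k≤V : k ≤ V
      k≤V = ≤-trans (n≤1+n k) (≤-trans (≤-reflexive (sym K≡1+k)) K≤V)

    Nsum-R : Nsum V ≡ Nsum (R ∸ 1)
    Nsum-R = begin
      Nsum V                                                  ≡⟨ cong Nsum (m+[n∸m]≡n r≤V) ⟨
      Nsum (R ∸ 1 + (V ∸ (R ∸ 1)))                            ≡⟨ sumBelow-+ (λ i → N (suc i)) (R ∸ 1) (V ∸ (R ∸ 1)) ⟩
      Nsum (R ∸ 1) + sumBelow (λ i → N (suc (R ∸ 1 + i))) (V ∸ (R ∸ 1))
        ≡⟨ cong (Nsum (R ∸ 1) +_) (sumBelow-zero (λ i → N (suc (R ∸ 1 + i))) (V ∸ (R ∸ 1)) λ i _ → N-zero R isR (suc (R ∸ 1 + i)) (≤-trans (≤-reflexive R≡) (s≤s (m≤m+n (R ∸ 1) i)))) ⟩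
      Nsum (R ∸ 1) + 0                                        ≡⟨ +-identityʳ _ ⟩
      Nsum (R ∸ 1)                                            ∎
      where
      open ≡-Reasoning
      R≡ : R ≡ suc (R ∸ 1)
      R≡ = sym (trans (+-comm 1 (R ∸ 1)) (m∸n+n≡m R≥1))
      r≤V : R ∸ 1 ≤ V
      r≤V = ≤-trans (m∸n≤m R 1) R≤V

    balance : alphSize _≟_ v + Nsum (R ∸ 1) + K ≡ suc V
    balance = begin
      alphSize _≟_ v + Nsum (R ∸ 1) + K          ≡⟨ cong₂ (λ a b → a + b + K) (alph≡C1 v) (sym Nsum-R) ⟩
      Cv 1 + Nsum V + K                           ≡⟨ cong (_+ K) (telescope V ≤-refl) ⟨
      Cv (suc V) + count (λ n → K ≤? suc n) V + K ≡⟨ cong (λ z → z + count (λ n → K ≤? suc n) V + K) (C-long v (suc V) ≤-refl) ⟩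
      count (λ n → K ≤? suc n) V + K              ≡⟨ unique-suffixes ⟩
      suc V                                       ∎
      where open ≡-Reasoning

UniqueAt : {A : Set} → List A → ℕ → Set
UniqueAt w p = ∀ j → j < length w → window w 1 j ≡ window w 1 p → j ≡ p

covers-unique⇒first : {A : Set} (w : List A) (_≟_ : DecidableEquality A) → ∀ n i p →
  i + n ≤ length w → i ≤ p → p < i + n → UniqueAt w p → Distinct.FirstOcc (Complexity._≟L_ _≟_) (window w n) i
covers-unique⇒first w _≟_ n i p fits i≤p p<i+n unique-p j j<i e with m≤n⇒∃[o]m+o≡n i≤p
... | o , refl = <⇒≢ j<i (+-cancelʳ-≡ o j i (unique-p (j + o) (<-trans (+-monoˡ-< o j<i) (<-≤-trans p<i+n fits)) same-letter))
  where
  m = n ∸ o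
  o+m≡n : o + m ≡ n
  o+m≡n = m+[n∸m]≡n (<⇒≤ (+-cancelˡ-< i o n p<i+n))
  1≤m : 1 ≤ m
  1≤m = m<n⇒0<n∸m (+-cancelˡ-< i o n p<i+n)
  fits′ : ∀ {x} → x ≤ i → x + (o + m) ≤ length w
  fits′ x≤i = ≤-trans (+-mono-≤ x≤i (≤-reflexive o+m≡n)) fits
  same-letter : window w 1 (j + o) ≡ window w 1 (i + o)
  same-letter = window-prefix w 1 m (j + o) (i + o) 1≤m
    (window-suffix w o m j i (fits′ (<⇒≤ j<i)) (fits′ ≤-refl) (subst (λ z → window w z j ≡ window w z i) (sym o+m≡n) e))

module Frame {A : Set} (_≟_ : DecidableEquality A) (w r v s : List A) (w≡rvs : w ≡ r ++ v ++ s)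
  (unique-r : ∀ p → p < length r → UniqueAt w p)
  (unique-s : ∀ p → length r + length v ≤ p → p < length w → UniqueAt w p) where

  open Complexity _≟_

  length-w : length w ≡ length r + (length v + length s)
  length-w = trans (cong length w≡rvs) (trans (length-++ r) (cong (length r +_) (length-++ v)))

  v≤w : length v ≤ length w
  v≤w = ≤-trans (m≤m+n (length v) (length s)) (≤-trans (m≤n+m _ (length r)) (≤-reflexive (sym length-w)))

  window-in-v : ∀ n i → i + n ≤ length v → window w n (length r + i) ≡ window v n i
  window-in-v n i fits = begin
    take n (drop (length r + i) w)          ≡⟨ cong (λ z → take n (drop (length r + i) z)) w≡rvs ⟩
    take n (drop (length r + i) (r ++ v ++ s)) ≡⟨ cong (take n) (drop-++ʳ i r (v ++ s)) ⟩
    take n (drop i (v ++ s))                ≡⟨ cong (take n) (drop-++ˡ i v s (≤-trans (m≤m+n i n) fits)) ⟩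
    take n (drop i v ++ s)                  ≡⟨ take-++ˡ n (drop i v) s n≤ ⟩
    take n (drop i v)                       ∎
    where
    open ≡-Reasoning
    n≤ : n ≤ length (drop i v)
    n≤ = subst (n ≤_) (sym (length-drop i v)) (subst (_≤ length v ∸ i) (m+n∸m≡n i n) (∸-monoˡ-≤ i fits))

  first-in-r : ∀ n i → i < length r → i + suc n ≤ length w → FirstOcc (window w (suc n)) i
  first-in-r n i i<r fits = covers-unique⇒first w _≟_ (suc n) i i fits ≤-refl (m<m+n i (s≤s z≤n)) (unique-r i i<r)

  first-into-s : ∀ n i → length r + length v ≤ i + n → i + suc n ≤ length w → FirstOcc (window w (suc n)) i
  first-into-s n i into-s fits = covers-unique⇒first w _≟_ (suc n) i (i + n) fits (m≤m+n i n) (+-monoʳ-< i (n<1+n n))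
    (unique-s (i + n) into-s (<-≤-trans (+-monoʳ-< i (n<1+n n)) fits))

  first-in-v : ∀ n i → i + n ≤ length v →
               (FirstOcc (window w n) (length r + i) → FirstOcc (window v n) i) ×
               (1 ≤ n → FirstOcc (window v n) i → FirstOcc (window w n) (length r + i))
  first-in-v n i fits = to , from
    where
    to : FirstOcc (window w n) (length r + i) → FirstOcc (window v n) i
    to first j j<i e = first (length r + j) (+-monoʳ-< (length r) j<i)
      (trans (window-in-v n j (≤-trans (+-monoˡ-≤ n (<⇒≤ j<i)) fits)) (trans e (sym (window-in-v n i fits))))
    from : 1 ≤ n → FirstOcc (window v n) i → FirstOcc (window w n) (length r + i)
    from 1≤n first j j<r+i e with j <? length r
    ... | yes j<r = <⇒≱ j<r (≤-trans (m≤m+n (length r) i)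
                      (≤-reflexive (unique-r j j<r (length r + i) r+i<w (sym (window-prefix w 1 n j (length r + i) 1≤n e)))))
      where
      r+i<w : length r + i < length w
      r+i<w = <-≤-trans (+-monoʳ-< (length r) (<-≤-trans (m<m+n i 1≤n) fits))
                        (≤-trans (+-monoʳ-≤ (length r) (m≤m+n (length v) (length s))) (≤-reflexive (sym length-w)))
    ... | no j≮r with m≤n⇒∃[o]m+o≡n (≮⇒≥ j≮r)
    ...   | j′ , refl = first j′ (+-cancelˡ-< (length r) j′ i j<r+i)
      (trans (sym (window-in-v n j′ (≤-trans (+-monoˡ-≤ n (<⇒≤ (+-cancelˡ-< (length r) j′ i j<r+i))) fits)))
             (trans e (window-in-v n i fits)))

  C-frame : ∀ n → 1 ≤ n → n ≤ length v → C _≟_ w n ≡ length r + C _≟_ v n + length s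
  C-frame (suc n) _ n<v = begin
    C _≟_ w (suc n)                                      ≡⟨ C≡count w (suc n) ⟩
    count FOw (length w ∸ n)                             ≡⟨ cong (count FOw) positions ⟩
    count FOw (R + M + S)                                ≡⟨ count-+ FOw (R + M) S ⟩
    count FOw (R + M) + count (λ i → FOw (R + M + i)) S  ≡⟨ cong₂ _+_ (count-+ FOw R M) (count-all _ S right) ⟩
    count FOw R + count (λ i → FOw (R + i)) M + S        ≡⟨ cong₂ (λ a b → a + b + S) (count-all FOw R left) middle ⟩
    R + count (firstOcc? (window v (suc n))) M + S       ≡⟨ cong (λ z → R + z + S) (C≡count v (suc n)) ⟨
    R + C _≟_ v (suc n) + S                              ∎
    where
    open ≡-Reasoning
    R = length r
    S = length s
    M = length v ∸ n
    FOw = firstOcc? (window w (suc n))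
    positions : length w ∸ n ≡ R + M + S
    positions = begin
      length w ∸ n         ≡⟨ cong (_∸ n) length-w ⟩
      R + (length v + S) ∸ n ≡⟨ +-∸-assoc R (≤-trans (<⇒≤ n<v) (m≤m+n (length v) S)) ⟩
      R + (length v + S ∸ n) ≡⟨ cong (R +_) (+-∸-comm S (<⇒≤ n<v)) ⟩
      R + (M + S)          ≡⟨ +-assoc R M S ⟨
      R + M + S            ∎
    left : ∀ i → i < R → FirstOcc (window w (suc n)) i
    left i i<R = first-in-r n i i<R
      (≤-trans (+-mono-≤ (<⇒≤ i<R) n<v) (≤-trans (+-monoʳ-≤ R (m≤m+n (length v) S)) (≤-reflexive (sym length-w))))
    middle : count (λ i → FOw (R + i)) M ≡ count (firstOcc? (window v (suc n))) M
    middle = count-ext _ _ M λ i i<M →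
      proj₁ (first-in-v (suc n) i (<∸⇒+suc≤ i n (length v) i<M)) ,
      proj₂ (first-in-v (suc n) i (<∸⇒+suc≤ i n (length v) i<M)) (s≤s z≤n)
    rearrange : ∀ a b c d → a + b + c + d ≡ a + (b + d) + c
    rearrange = solve-∀
    end-of-window : ∀ i → R + M + i + n ≡ R + length v + i
    end-of-window i = trans (rearrange R M i n) (cong (λ z → R + z + i) (m∸n+n≡m (<⇒≤ n<v)))
    right : ∀ i → i < S → FirstOcc (window w (suc n)) (R + M + i)
    right i i<S = first-into-s n (R + M + i) (≤-trans (m≤m+n (R + length v) i) (≤-reflexive (sym (end-of-window i)))) fits
      where
      fits : R + M + i + suc n ≤ length w
      fits = ≤-trans (≤-reflexive (trans (+-suc (R + M + i) n) (trans (cong suc (end-of-window i)) (sym (+-suc (R + length v) i)))))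
                     (≤-trans (+-monoʳ-≤ (R + length v) i<S) (≤-reflexive (trans (+-assoc R (length v) S) (sym length-w))))

  C-beyond-v : ∀ n → length v < n → n ≤ suc (length w) → C _≟_ w n + n ≡ suc (length w)
  C-beyond-v (suc n) (s≤s v≤n) (s≤s n≤w) = begin
    C _≟_ w (suc n) + suc n            ≡⟨ cong (_+ suc n) (trans (C≡count w (suc n)) (count-all _ _ all-first)) ⟩
    length w ∸ n + suc n               ≡⟨ +-suc (length w ∸ n) n ⟩
    suc (length w ∸ n + n)             ≡⟨ cong suc (m∸n+n≡m n≤w) ⟩
    suc (length w)                     ∎
    where
    open ≡-Reasoning
    all-first : ∀ i → i < length w ∸ n → FirstOcc (window w (suc n)) i
    all-first i i< with i <? length r
    ... | yes i<r = first-in-r n i i<r (<∸⇒+suc≤ i n (length w) i<)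
    ... | no i≮r  = first-into-s n i (+-mono-≤ (≮⇒≥ i≮r) v≤n) (<∸⇒+suc≤ i n (length w) i<)

module Trapezoid (c : ℕ → ℕ) (R K L : ℕ) (1≤R : 1 ≤ R) (1≤K : 1 ≤ K) (R⊔K≤L : R ⊔ K ≤ L)
  (step : ∀ n → 1 ≤ n → n ≤ L → c (suc n) + ind (K ≤? n) ≡ c n + ind (n <? R)) where

  rise : ∀ i → 1 ≤ i → i ≤ R ⊓ K → c i ≡ c 1 + i ∸ 1
  rise (suc zero)    _ _  = sym (m+n∸n≡m (c 1) 1)
  rise (suc (suc i)) _ le = begin
    c (suc (suc i))                           ≡⟨ +-identityʳ _ ⟨
    c (suc (suc i)) + 0                       ≡⟨ cong (c (suc (suc i)) +_) (ind-no (K ≤? suc i) λ K≤ → <⇒≱ (<-≤-trans le (m⊓n≤n R K)) K≤) ⟨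
    c (suc (suc i)) + ind (K ≤? suc i)        ≡⟨ step (suc i) (s≤s z≤n) (≤-trans (<⇒≤ le) (≤-trans (m⊓n≤m R K) (≤-trans (m≤m⊔n R K) R⊔K≤L))) ⟩
    c (suc i) + ind (suc i <? R)              ≡⟨ cong₂ _+_ (rise (suc i) (s≤s z≤n) (<⇒≤ le)) (ind-yes (suc i <? R) (<-≤-trans le (m⊓n≤m R K))) ⟩
    c 1 + suc i ∸ 1 + 1                       ≡⟨ cong (_+ 1) (cong (_∸ 1) (+-suc (c 1) i)) ⟩
    c 1 + i + 1                               ≡⟨ trans (+-assoc (c 1) i 1) (cong (c 1 +_) (+-comm i 1)) ⟩
    c 1 + suc i                               ≡⟨ cong (_∸ 1) (+-suc (c 1) (suc i)) ⟨
    c 1 + suc (suc i) ∸ 1                     ∎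
    where open ≡-Reasoning

  plateau : ∀ i → R ⊓ K ≤ i → i + 1 ≤ R ⊔ K → c (suc i) ≡ c i
  plateau i m≤i i+1≤M = +-cancelʳ-≡ (ind (K ≤? i)) (c (suc i)) (c i) (trans (step i 1≤i i≤L) (cong (c i +_) same))
    where
    i<M : i < R ⊔ K
    i<M = subst (_≤ R ⊔ K) (+-comm i 1) i+1≤M
    1≤i : 1 ≤ i
    1≤i = ≤-trans (⊓-glb 1≤R 1≤K) m≤i
    i≤L : i ≤ L
    i≤L = ≤-trans (<⇒≤ i<M) R⊔K≤L
    -- Between the thresholds exactly one of n < R and K ≤ n holds.
    same : ind (i <? R) ≡ ind (K ≤? i)
    same with K ≤? i | i <? R
    ... | yes _   | yes _   = refl
    ... | yes K≤i | no i≮R  = ⊥-elim (<⇒≱ i<M (⊔-lub (≮⇒≥ i≮R) K≤i))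
    ... | no K≰i  | yes i<R = ⊥-elim (<⇒≱ (⊓-glb i<R (≰⇒> K≰i)) m≤i)
    ... | no _    | no _    = refl

  fall : ∀ i → R ⊔ K ≤ i → i ≤ L → c i ≡ suc (c (suc i))
  fall i M≤i i≤L = sym (begin
    suc (c (suc i))             ≡⟨ +-comm 1 (c (suc i)) ⟩
    c (suc i) + 1               ≡⟨ cong (c (suc i) +_) (ind-yes (K ≤? i) (≤-trans (m≤n⊔m R K) M≤i)) ⟨
    c (suc i) + ind (K ≤? i)    ≡⟨ step i (≤-trans (≤-trans 1≤R (m≤m⊔n R K)) M≤i) i≤L ⟩
    c i + ind (i <? R)          ≡⟨ cong (c i +_) (ind-no (i <? R) λ i<R → <⇒≱ i<R (≤-trans (m≤m⊔n R K) M≤i)) ⟩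
    c i + 0                     ≡⟨ +-identityʳ (c i) ⟩
    c i                         ∎)
    where open ≡-Reasoning

module TrapezoidSteps (c : ℕ → ℕ) (a m M L : ℕ)
  (rise : ∀ i → 1 ≤ i → i ≤ m → c i ≡ a + i ∸ 1)
  (plateau : ∀ i → m ≤ i → i + 1 ≤ M → c (suc i) ≡ c i)
  (fall : ∀ i → M ≤ i → i ≤ L → c i ≡ suc (c (suc i)))
  (vanish : ∀ i → L < i → c i ≡ 0) where

  step-below : ∀ n → 1 ≤ n → n < m → c (suc n) ≡ suc (c n)
  step-below (suc n) _ n<m = begin
    c (suc (suc n))  ≡⟨ rise (suc (suc n)) (s≤s z≤n) n<m ⟩
    a + suc (suc n) ∸ 1 ≡⟨ cong (_∸ 1) (+-suc a (suc n)) ⟩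
    a + suc n        ≡⟨ +-suc a n ⟩
    suc (a + n)      ≡⟨ cong suc (cong (_∸ 1) (+-suc a n)) ⟨
    suc (a + suc n ∸ 1) ≡⟨ cong suc (rise (suc n) (s≤s z≤n) (<⇒≤ n<m)) ⟨
    suc (c (suc n))  ∎
    where open ≡-Reasoning

  step-above : ∀ n → m ≤ n → c (suc n) ≤ c n
  step-above n m≤n with n + 1 ≤? M | n ≤? L
  ... | yes n+1≤M | _     = ≤-reflexive (plateau n m≤n n+1≤M)
  ... | no n+1≰M  | yes n≤L = ≤-trans (n≤1+n _) (≤-reflexive (sym (fall n M≤n n≤L)))
    where
    M≤n : M ≤ n
    M≤n = ≤-pred (subst (suc M ≤_) (+-comm n 1) (≰⇒> n+1≰M))
  ... | no _      | no n≰L  = ≤-trans (≤-reflexive (vanish (suc n) (≤-trans (≰⇒> n≰L) (n≤1+n n)))) z≤n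

  step-≤1 : ∀ n → 1 ≤ n → c (suc n) ≤ suc (c n)
  step-≤1 n 1≤n with n <? m
  ... | yes n<m = ≤-reflexive (step-below n 1≤n n<m)
  ... | no n≮m  = ≤-trans (step-above n (≮⇒≥ n≮m)) (n≤1+n _)

module Criterion {A : Set} (_≟_ : DecidableEquality A) (w r v s : List A) (w≡rvs : w ≡ r ++ v ++ s)
  (unique-r : ∀ p → p < length r → UniqueAt w p)
  (unique-s : ∀ p → length r + length v ≤ p → p < length w → UniqueAt w p)
  (v≢[] : 1 ≤ length v) (R K : ℕ) (isR : IsR _≟_ v R) (isK : IsK _≟_ v K) (K>1⊎R≡1 : 1 < K ⊎ R ≡ 1) where

  open Complexity _≟_
  open Branching _≟_ v
  open Thresholds R K isR isK v≢[]
  open Frame _≟_ w r v s w≡rvs unique-r unique-s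

  Cw : ℕ → ℕ
  Cw n = C _≟_ w n

  alph-frame : alphSize _≟_ w ≡ length r + alphSize _≟_ v + length s
  alph-frame = trans (alph≡C1 w) (trans (C-frame 1 (s≤s z≤n) v≢[]) (cong (λ z → length r + z + length s) (sym (alph≡C1 v))))

  equation⇔Nsum : (length w + 2 ≡ R + K + alphSize _≟_ w → Nsum (R ∸ 1) ≡ R ∸ 1) ×
                  (Nsum (R ∸ 1) ≡ R ∸ 1 → length w + 2 ≡ R + K + alphSize _≟_ w)
  equation⇔Nsum = (λ e → +-cancelˡ-≡ X _ _ (trans (sym lhs) (trans e rhs))) ,
                  (λ e → trans lhs (trans (cong (X +_) e) (sym rhs)))
    where
    a = alphSize _≟_ v
    X = length r + length s + a + K + 1
    lhs-shape : ∀ r V s → r + (V + s) + 2 ≡ r + s + suc V + 1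
    lhs-shape = solve-∀
    lhs-regroup : ∀ r s a S K → r + s + (a + S + K) + 1 ≡ r + s + a + K + 1 + S
    lhs-regroup = solve-∀
    rhs-regroup : ∀ q K r a s → q + 1 + K + (r + a + s) ≡ r + s + a + K + 1 + q
    rhs-regroup = solve-∀
    lhs : length w + 2 ≡ X + Nsum (R ∸ 1)
    lhs = trans (cong (_+ 2) length-w) (trans (lhs-shape (length r) V (length s))
            (trans (cong (λ z → length r + length s + z + 1) (sym balance)) (lhs-regroup (length r) (length s) a (Nsum (R ∸ 1)) K)))
    rhs : R + K + alphSize _≟_ w ≡ X + (R ∸ 1)
    rhs = trans (cong₂ (λ x y → x + K + y) (sym (m∸n+n≡m R≥1)) alph-frame) (rhs-regroup (R ∸ 1) K (length r) a (length s))

  N-beyond : ∀ n → V ≤ n → N n ≡ 0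
  N-beyond n V≤n = cong (count (branch? n)) (m≤n⇒m∸n≡0 V≤n)

  Cv-V : Cv V ≡ 1
  Cv-V = begin
    Cv V                     ≡⟨ +-identityʳ (Cv V) ⟨
    Cv V + 0                 ≡⟨ cong (Cv V +_) (N-beyond V ≤-refl) ⟨
    Cv V + N V               ≡⟨ C-step-K V ≤-refl ⟨
    Cv (suc V) + ind (K ≤? V) ≡⟨ cong₂ _+_ (C-long v (suc V) ≤-refl) (ind-yes (K ≤? V) K≤V) ⟩
    1                        ∎
    where open ≡-Reasoning

  C-from-v : ∀ n → V ≤ n → n ≤ suc (length w) → Cw n + n ≡ suc (length w)
  C-from-v n V≤n n≤w with m≤n⇒m<n∨m≡n V≤n
  ... | inj₁ V<n  = C-beyond-v n V<n n≤w
  ... | inj₂ refl = begin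
    Cw V + V                           ≡⟨ cong (_+ V) (trans (C-frame V v≢[] ≤-refl) (cong (λ z → length r + z + length s) Cv-V)) ⟩
    length r + 1 + length s + V        ≡⟨ regroup (length r) (length s) V ⟩
    suc (length r + (V + length s))    ≡⟨ cong suc length-w ⟨
    suc (length w)                     ∎
    where
    open ≡-Reasoning
    regroup : ∀ r s V → r + 1 + s + V ≡ suc (r + (V + s))
    regroup = solve-∀

  profile : ∀ n → 1 ≤ n → n ≤ length w → Cw (suc n) + ind (K ≤? n) ≡ Cw n + N n
  profile n 1≤n n≤w with n <? V
  ... | yes n<V = begin
    Cw (suc n) + ind (K ≤? n)                         ≡⟨ cong (_+ ind (K ≤? n)) (C-frame (suc n) (s≤s z≤n) n<V) ⟩
    length r + Cv (suc n) + length s + ind (K ≤? n)   ≡⟨ regroup (length r) (Cv (suc n)) (length s) (ind (K ≤? n)) ⟩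
    length r + length s + (Cv (suc n) + ind (K ≤? n)) ≡⟨ cong (length r + length s +_) (C-step-K n (<⇒≤ n<V)) ⟩
    length r + length s + (Cv n + N n)                ≡⟨ regroup (length r) (Cv n) (length s) (N n) ⟨
    length r + Cv n + length s + N n                  ≡⟨ cong (_+ N n) (C-frame n 1≤n (<⇒≤ n<V)) ⟨
    Cw n + N n                                        ∎
    where
    open ≡-Reasoning
    regroup : ∀ r a s t → r + a + s + t ≡ r + s + (a + t)
    regroup = solve-∀
  ... | no n≮V = +-cancelʳ-≡ n _ _ (begin
    Cw (suc n) + ind (K ≤? n) + n  ≡⟨ cong (λ z → Cw (suc n) + z + n) (ind-yes (K ≤? n) (≤-trans K≤V V≤n)) ⟩
    Cw (suc n) + 1 + n             ≡⟨ +-assoc (Cw (suc n)) 1 n ⟩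
    Cw (suc n) + suc n             ≡⟨ C-from-v (suc n) (≤-trans V≤n (n≤1+n n)) (s≤s n≤w) ⟩
    suc (length w)                 ≡⟨ C-from-v n V≤n (≤-trans n≤w (n≤1+n _)) ⟨
    Cw n + n                       ≡⟨ cong (λ z → z + n) (+-identityʳ (Cw n)) ⟨
    Cw n + 0 + n                   ≡⟨ cong (λ z → Cw n + z + n) (N-beyond n V≤n) ⟨
    Cw n + N n + n                 ∎)
    where
    open ≡-Reasoning
    V≤n : V ≤ n
    V≤n = ≮⇒≥ n≮V

  R≡1+ : R ≡ suc (R ∸ 1)
  R≡1+ = sym (trans (+-comm 1 (R ∸ 1)) (m∸n+n≡m R≥1))

  one-each⇒Nsum : (∀ n → 1 ≤ n → n < R → N n ≤ 1) → Nsum (R ∸ 1) ≡ R ∸ 1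
  one-each⇒Nsum ≤1 = ≤-antisym (sumBelow-≤ _ (R ∸ 1) λ i i< → ≤1 (suc i) (s≤s z≤n) (below i i<))
                               (sumBelow-≥ _ (R ∸ 1) λ i i< → N-positive R isR (suc i) (s≤s z≤n) (below i i<))
    where
    below : ∀ i → i < R ∸ 1 → suc i < R
    below i i< = ≤-trans (s≤s i<) (≤-reflexive (sym R≡1+))

  Nsum⇒one-each : Nsum (R ∸ 1) ≡ R ∸ 1 → ∀ n → 1 ≤ n → n < R → N n ≡ 1
  Nsum⇒one-each e (suc i) _ i+1<R =
    sumBelow-all1 _ (R ∸ 1) (λ j j< → N-positive R isR (suc j) (s≤s z≤n) (≤-trans (s≤s j<) (≤-reflexive (sym R≡1+)))) e i
                  (≤-pred (≤-trans i+1<R (≤-reflexive R≡1+)))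

  alph≥1 : ∀ (xs : List A) → 1 ≤ length xs → 1 ≤ alphSize _≟_ xs
  alph≥1 (x ∷ xs) _ = s≤s z≤n

  w≢[] : ¬ w ≡ []
  w≢[] e = <⇒≱ (≤-trans v≢[] v≤w) (≤-reflexive (cong length e))

  one-each⇒GT : (∀ n → 1 ≤ n → n < R → N n ≡ 1) → GT _≟_ w
  one-each⇒GT ones with 2 ≤? alphSize _≟_ w
  ... | no a≱2 = inj₂ (≤-antisym (≤-pred (≰⇒> a≱2)) a≥1 , w≢[])
    where
    a≥1 : 1 ≤ alphSize _≟_ w
    a≥1 = ≤-trans (alph≥1 v v≢[]) (≤-trans (≤-trans (m≤n+m _ (length r)) (m≤m+n _ (length s))) (≤-reflexive (sym alph-frame)))
  ... | yes a≥2 = inj₁ (a≥2 , R ⊓ K , R ⊔ K , ⊓-glb R≥1 K≥1 , ≤-trans (m⊓n≤m R K) (m≤m⊔n R K) , C-zero w ,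
                        rise′ , plateau , fall)
    where
    N≡ : ∀ n → 1 ≤ n → N n ≡ ind (n <? R)
    N≡ n 1≤n with n <? R
    ... | yes n<R = ones n 1≤n n<R
    ... | no n≮R  = N-zero R isR n (≮⇒≥ n≮R)
    open Trapezoid Cw R K (length w) R≥1 K≥1 (≤-trans (⊔-lub R≤V K≤V) v≤w)
                   (λ n 1≤n n≤w → trans (profile n 1≤n n≤w) (cong (Cw n +_) (N≡ n 1≤n)))
    rise′ : ∀ i → 1 ≤ i → i ≤ R ⊓ K → Cw i ≡ alphSize _≟_ w + i ∸ 1
    rise′ i 1≤i i≤m = trans (rise i 1≤i i≤m) (cong (λ a → a + i ∸ 1) (sym (alph≡C1 w)))

  -- When K > 1 the complexity of w cannot rise at both lengths K - 1 and K: that would mean one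
  -- branching point at length K - 1 and two at length K, which the key lemma forbids.
  no-rise-through-K : 1 < K → Cw (suc (K ∸ 1)) ≡ suc (Cw (K ∸ 1)) → Cw (suc K) ≡ suc (Cw K) → ⊥
  no-rise-through-K 1<K rise-k rise-K =
    OneBranching.at-most-one k (subst (_≤ V) K≡1+k K≤V) unique (≤-reflexive N-k) (subst (λ z → 2 ≤ N z) K≡1+k (≤-reflexive (sym N-K)))
    where
    k = K ∸ 1
    K≡1+k : K ≡ suc k
    K≡1+k = sym (trans (+-comm 1 k) (m∸n+n≡m K≥1))
    k<K : k < K
    k<K = ≤-reflexive (sym K≡1+k)
    1≤k : 1 ≤ k
    1≤k = ≤-pred (≤-trans 1<K (≤-reflexive K≡1+k))
    unique : SuffixUnique (suc k)
    unique = subst SuffixUnique K≡1+k (proj₂ (suffixUnique⇔K K isK K K≤V) ≤-refl)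
    N-k : N k ≡ 1
    N-k = +-cancelˡ-≡ (Cw k) _ _ (begin
      Cw k + N k                 ≡⟨ profile k 1≤k (≤-trans (<⇒≤ k<K) (≤-trans K≤V v≤w)) ⟨
      Cw (suc k) + ind (K ≤? k)  ≡⟨ cong₂ _+_ rise-k (ind-no (K ≤? k) (<⇒≱ k<K)) ⟩
      suc (Cw k) + 0             ≡⟨ trans (+-identityʳ _) (+-comm 1 (Cw k)) ⟩
      Cw k + 1                   ∎)
      where open ≡-Reasoning
    N-K : N K ≡ 2
    N-K = +-cancelˡ-≡ (Cw K) _ _ (begin
      Cw K + N K                 ≡⟨ profile K K≥1 (≤-trans K≤V v≤w) ⟨
      Cw (suc K) + ind (K ≤? K)  ≡⟨ cong₂ _+_ rise-K (ind-yes (K ≤? K) ≤-refl) ⟩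
      suc (Cw K) + 1             ≡⟨ cong (_+ 1) (+-comm 1 (Cw K)) ⟩
      Cw K + 1 + 1               ≡⟨ +-assoc (Cw K) 1 1 ⟩
      Cw K + 2                   ∎)
      where open ≡-Reasoning

  below-R⇒≤w : ∀ {n} → n < R → n ≤ length w
  below-R⇒≤w n<R = ≤-trans (<⇒≤ n<R) (≤-trans R≤V v≤w)

  module Forward (m M : ℕ)
    (rise : ∀ i → 1 ≤ i → i ≤ m → Cw i ≡ alphSize _≟_ w + i ∸ 1)
    (plateau : ∀ i → m ≤ i → i + 1 ≤ M → Cw (suc i) ≡ Cw i)
    (fall : ∀ i → M ≤ i → i ≤ length w → Cw i ≡ suc (Cw (suc i))) where

    open TrapezoidSteps Cw (alphSize _≟_ w) m M (length w) rise plateau fall (C-long w)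

    at-most-one : ∀ n → 1 ≤ n → n < R → N n ≤ 1
    at-most-one n 1≤n n<R with K ≤? n | m ≤? n
    ... | no K≰n | _ = +-cancelˡ-≤ (Cw n) (N n) 1 (begin
      Cw n + N n                 ≡⟨ profile n 1≤n (below-R⇒≤w n<R) ⟨
      Cw (suc n) + ind (K ≤? n)  ≡⟨ cong (Cw (suc n) +_) (ind-no (K ≤? n) K≰n) ⟩
      Cw (suc n) + 0             ≡⟨ +-identityʳ _ ⟩
      Cw (suc n)                 ≤⟨ step-≤1 n 1≤n ⟩
      suc (Cw n)                 ≡⟨ +-comm 1 (Cw n) ⟩
      Cw n + 1                   ∎)
      where open ≤-Reasoning
    ... | yes K≤n | yes m≤n = +-cancelˡ-≤ (Cw n) (N n) 1 (begin
      Cw n + N n                 ≡⟨ profile n 1≤n (below-R⇒≤w n<R) ⟨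
      Cw (suc n) + ind (K ≤? n)  ≡⟨ cong (Cw (suc n) +_) (ind-yes (K ≤? n) K≤n) ⟩
      Cw (suc n) + 1             ≤⟨ +-monoˡ-≤ 1 (step-above n m≤n) ⟩
      Cw n + 1                   ∎)
      where open ≤-Reasoning
    ... | yes K≤n | no m≰n = ⊥-elim (impossible K>1⊎R≡1)
      where
      -- Here K ≤ n < m: the complexity rises through K, which needs R > n ≥ 1 and hence K > 1.
      K<m : K < m
      K<m = <-≤-trans (s≤s K≤n) (≰⇒> m≰n)
      K≡1+k : K ≡ suc (K ∸ 1)
      K≡1+k = sym (trans (+-comm 1 (K ∸ 1)) (m∸n+n≡m K≥1))
      impossible : 1 < K ⊎ R ≡ 1 → ⊥
      impossible (inj₂ R≡1) = <⇒≱ n<R (≤-trans (≤-reflexive R≡1) 1≤n)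
      impossible (inj₁ 1<K) = no-rise-through-K 1<K
        (step-below (K ∸ 1) (≤-pred (≤-trans 1<K (≤-reflexive K≡1+k))) (<-trans (≤-reflexive (sym K≡1+k)) K<m))
        (step-below K K≥1 K<m)

  GT⇒at-most-one : GT _≟_ w → ∀ n → 1 ≤ n → n < R → N n ≤ 1
  GT⇒at-most-one (inj₁ (_ , m , M , _ , _ , _ , rise , plateau , fall)) = Forward.at-most-one m M rise plateau fall
  GT⇒at-most-one (inj₂ (a≡1 , _)) n 1≤n n<R with proj₂ (proj₂ isR) 1 ≤-refl (≤-trans (s≤s 1≤n) n<R)
  ... | u , _ , special = ⊥-elim (<⇒≱ (≤-trans (rightSpecial⇒alph≥2 u special) alph-v≤alph-w) (≤-reflexive a≡1))
    where
    alph-v≤alph-w : alphSize _≟_ v ≤ alphSize _≟_ w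
    alph-v≤alph-w = ≤-trans (≤-trans (m≤n+m _ (length r)) (m≤m+n _ (length s))) (≤-reflexive (sym alph-frame))

  criterion : (GT _≟_ w → length w + 2 ≡ R + K + alphSize _≟_ w) × (length w + 2 ≡ R + K + alphSize _≟_ w → GT _≟_ w)
  criterion = (λ gt → proj₂ equation⇔Nsum (one-each⇒Nsum (GT⇒at-most-one gt))) ,
              (λ e → one-each⇒GT (Nsum⇒one-each (proj₁ equation⇔Nsum e)))

dropWhile-stops : {A : Set} {P : Pred A 0ℓ} (P? : Decidable P) → ∀ xs → (∃ λ a → a ∈ xs × ¬ P a) →
                  ∃₂ λ y ys → dropWhile P? xs ≡ y ∷ ys × ¬ P y
dropWhile-stops P? (x ∷ xs) (a , a∈ , ¬pa) with P? x
... | no ¬px = x , xs , refl , ¬px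
... | yes px with a∈
...   | here refl  = ⊥-elim (¬pa px)
...   | there a∈xs = dropWhile-stops P? xs (a , a∈xs , ¬pa)

module HeartFrame {A : Set} (_≟_ : DecidableEquality A) (w : List A) where

  open Complexity _≟_

  Once : A → Set
  Once a = length (filter (a ≟_) w) ≡ 1

  once? : Decidable Once
  once? a = length (filter (a ≟_) w) ≟ℕ 1

  -- X is w without the suffix s.
  r s X : List A
  r = heartPrefix _≟_ w
  s = heartSuffix _≟_ w
  X = reverse (dropWhile once? (reverse w))

  w≡r++ : w ≡ r ++ dropWhile once? w
  w≡r++ = sym (takeWhile++dropWhile once? w)

  w≡X++s : w ≡ X ++ s
  w≡X++s = begin
    w                                                                      ≡⟨ reverse-involutive w ⟨
    reverse (reverse w)                                                    ≡⟨ cong reverse (takeWhile++dropWhile once? (reverse w)) ⟨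
    reverse (takeWhile once? (reverse w) ++ dropWhile once? (reverse w))   ≡⟨ reverse-++ (takeWhile once? (reverse w)) _ ⟩
    X ++ s                                                                 ∎
    where open ≡-Reasoning

  r≤w : length r ≤ length w
  r≤w = ≤-trans (m≤m+n (length r) _) (≤-reflexive (sym (trans (cong length w≡r++) (length-++ r))))

  X+s≡w : length X + length s ≡ length w
  X+s≡w = trans (sym (length-++ X)) (cong length (sym w≡X++s))

  once⇒single : ∀ a → Once a → ¬ (2 ≤ count (λ i → [ a ] ≟L window w 1 i) (length w))
  once⇒single a once two = <⇒≱ two (≤-reflexive (trans (sym (letterCount≡count a w)) once))

  once⇒unique : ∀ a p → Once a → p < length w → window w 1 p ≡ [ a ] → UniqueAt w p
  once⇒unique a p once p<w ep j j<w ej with <-cmp j p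
  ... | tri< j<p _ _ = ⊥-elim (once⇒single a once (∃₂⇒count≥2 _ (length w) j p j<p p<w (sym (trans ej ep)) (sym ep)))
  ... | tri≈ _ j≡p _ = j≡p
  ... | tri> _ _ p<j = ⊥-elim (once⇒single a once (∃₂⇒count≥2 _ (length w) p j p<j j<w (sym ep) (sym (trans ej ep))))

  another-occurrence : ∀ a p → ¬ Once a → p < length w → window w 1 p ≡ [ a ] →
                       ∃ λ q → q < length w × ¬ q ≡ p × window w 1 q ≡ [ a ]
  another-occurrence a p ¬once p<w ep with count≥2⇒∃₂ _ (length w) two
    where
    at-least-one : 1 ≤ count (λ i → [ a ] ≟L window w 1 i) (length w)
    at-least-one = ∃⇒count≥1 (λ i → [ a ] ≟L window w 1 i) (length w) p p<w (sym ep)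
    two : 2 ≤ count (λ i → [ a ] ≟L window w 1 i) (length w)
    two with m≤n⇒m<n∨m≡n at-least-one
    ... | inj₁ 1<c = 1<c
    ... | inj₂ 1≡c = ⊥-elim (¬once (trans (letterCount≡count a w) (sym 1≡c)))
  ... | i , j , i<j , j<w , ei , ej with i ≟ℕ p
  ...   | no i≢p = i , <-trans i<j j<w , i≢p , sym ei
  ...   | yes refl = j , j<w , (λ j≡i → <⇒≢ i<j (sym j≡i)) , sym ej

  unique-r : ∀ p → p < length r → UniqueAt w p
  unique-r p p<r with window-letter r p p<r
  ... | a , ea , a∈r = once⇒unique a p (All.lookup (all-takeWhile once? w) a∈r) (<-≤-trans p<r r≤w)
                         (trans (trans (cong (λ z → window z 1 p) w≡r++) (window-++ˡ r _ p p<r)) ea)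

  letter-in-s : ∀ p → length X ≤ p → p < length w → ∃ λ a → window w 1 p ≡ [ a ] × Once a
  letter-in-s p X≤p p<w with m≤n⇒∃[o]m+o≡n X≤p
  ... | q , refl with window-letter s q (+-cancelˡ-< (length X) q (length s) (subst (length X + q <_) (sym X+s≡w) p<w))
  ...   | a , ea , a∈s = a , trans (cong (λ z → window z 1 (length X + q)) w≡X++s) (trans (window-++ʳ X s 1 q) ea) ,
                         All.lookup (all-takeWhile once? (reverse w)) (Any.reverse⁻ a∈s)

  unique-s : ∀ p → length X ≤ p → p < length w → UniqueAt w p
  unique-s p X≤p p<w with letter-in-s p X≤p p<w
  ... | a , ea , once = once⇒unique a p once p<w ea

  repeated-letter : alphSize _≟_ w < length w → ∃ λ a → a ∈ w × ¬ Once a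
  repeated-letter lt with count<⇒∃¬ (firstOcc? (window w 1)) (length w) (subst (_< length w) (alph≡count w) lt)
  ... | p , p<w , ¬first with ¬all¬⇒∃ (λ j → window w 1 j ≟L window w 1 p) p ¬first
  ...   | j , j<p , e with window-letter w p p<w
  ...     | a , ea , a∈w = a , a∈w , λ once → <⇒≢ j<p (once⇒unique a p once p<w ea j (<-trans j<p p<w) e)

  heart-distinct : ¬ (alphSize _≟_ w < length w) → heart _≟_ w ≡ w
  heart-distinct distinct with alphSize _≟_ w <? length w
  ... | yes repeated = ⊥-elim (distinct repeated)
  ... | no _         = refl

  -- When all letters of w are distinct, w has no right special factor, so R = 1.
  distinct⇒R≡1 : ¬ (alphSize _≟_ w < length w) → ∀ R → IsR _≟_ w R → R ≡ 1
  distinct⇒R≡1 distinct R isR@(1≤R , _ , special) = ≤-antisym (≮⇒≥ R≮2) 1≤R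
    where
    open Branching _≟_ w using (rightSpecial⇒rsPair)
    R≮2 : ¬ (1 < R)
    R≮2 1<R with special 1 ≤-refl 1<R
    ... | u , lu , rs with rightSpecial⇒rsPair 1 u lu rs
    ...   | i , j , (ri , rj , e , ne) , _ with <-cmp i j
    ...     | tri< i<j _ _ = distinct (subst (_< length w) (sym (alph≡count w))
                               (∃¬⇒count< _ (length w) j (≤-trans (s≤s (m≤m+n j 1)) (≤-trans (≤-reflexive (sym (+-suc j 1))) rj)) λ first → first i i<j e))
    ...     | tri≈ _ refl _ = ne refl
    ...     | tri> _ _ j<i = distinct (subst (_< length w) (sym (alph≡count w))
                               (∃¬⇒count< _ (length w) i (≤-trans (s≤s (m≤m+n i 1)) (≤-trans (≤-reflexive (sym (+-suc i 1))) ri)) λ first → first j j<i (sym e)))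

  -- When some letter repeats, the heart v is non-empty, w = r v s, and the last letter of v
  -- occurs earlier in v, so the suffix of length 1 of v is not unique: K > 1.
  module Repeated (repeated : alphSize _≟_ w < length w) where

    after-r : ∃₂ λ x t → dropWhile once? w ≡ x ∷ t × ¬ Once x
    after-r = dropWhile-stops once? w (repeated-letter repeated)

    before-s : ∃₂ λ y t → dropWhile once? (reverse w) ≡ y ∷ t × ¬ Once y
    before-s with repeated-letter repeated
    ... | a , a∈w , ¬once = dropWhile-stops once? (reverse w) (a , Any.reverse⁺ a∈w , ¬once)

    r<X : length r < length X
    r<X with after-r
    ... | x , t , e , ¬once-x = ≰⇒> λ X≤r → ¬once-x (once-at-r X≤r)
      where
      w≡r++x∷t : w ≡ r ++ x ∷ t
      w≡r++x∷t = trans w≡r++ (cong (r ++_) e)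
      r<w : length r < length w
      r<w = ≤-trans (≤-trans (≤-reflexive (+-comm 1 (length r))) (+-monoʳ-≤ (length r) (s≤s z≤n)))
                    (≤-reflexive (sym (trans (cong length w≡r++x∷t) (length-++ r))))
      at-r : window w 1 (length r) ≡ [ x ]
      at-r = trans (cong (λ z → window z 1 (length r)) w≡r++x∷t)
                   (trans (cong (λ i → window (r ++ x ∷ t) 1 i) (sym (+-identityʳ (length r)))) (window-++ʳ r (x ∷ t) 1 0))
      once-at-r : length X ≤ length r → Once x
      once-at-r X≤r with letter-in-s (length r) X≤r r<w
      ... | b , eb , once-b = subst Once (∷-injʳ-[] (trans (sym eb) at-r)) once-b

    v : List A
    v = drop (length r) X

    X≡r++v : X ≡ r ++ v
    X≡r++v = trans (sym (take++drop≡id (length r) X)) (cong (_++ v) take-r)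
      where
      take-r : take (length r) X ≡ r
      take-r = begin
        take (length r) X                     ≡⟨ take-++ˡ (length r) X s (<⇒≤ r<X) ⟨
        take (length r) (X ++ s)              ≡⟨ cong (take (length r)) (trans (sym w≡X++s) w≡r++) ⟩
        take (length r) (r ++ dropWhile once? w) ≡⟨ take-length-++ r _ ⟩
        r                                     ∎
        where open ≡-Reasoning

    w≡rvs : w ≡ r ++ v ++ s
    w≡rvs = trans w≡X++s (trans (cong (_++ s) X≡r++v) (++-assoc r v s))

    r+v≡X : length r + length v ≡ length X
    r+v≡X = sym (trans (cong length X≡r++v) (length-++ r))

    v≢[] : 1 ≤ length v
    v≢[] = +-cancelˡ-≤ (length r) 1 (length v) (≤-trans (≤-reflexive (+-comm (length r) 1)) (≤-trans r<X (≤-reflexive (sym r+v≡X))))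

    heart≡v : heart _≟_ w ≡ v
    heart≡v with alphSize _≟_ w <? length w
    ... | no ¬repeated = ⊥-elim (¬repeated repeated)
    ... | yes _ = begin
      take (length w ∸ length r ∸ length s) (drop (length r) w)   ≡⟨ cong₂ take length-v drop-r ⟩
      take (length v) (v ++ s)                                    ≡⟨ take-length-++ v s ⟩
      v                                                           ∎
      where
      open ≡-Reasoning
      length-v : length w ∸ length r ∸ length s ≡ length v
      length-v = trans (cong (λ z → z ∸ length r ∸ length s) (trans (cong length w≡rvs) (trans (length-++ r) (cong (length r +_) (length-++ v)))))
                       (trans (cong (_∸ length s) (m+n∸m≡n (length r) (length v + length s))) (m+n∸n≡m (length v) (length s)))
      drop-r : drop (length r) w ≡ v ++ s
      drop-r = trans (cong₂ drop (sym (+-identityʳ (length r))) w≡rvs) (drop-++ʳ 0 r (v ++ s))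

    window-v : ∀ i → i < length v → window v 1 i ≡ window w 1 (length r + i)
    window-v i i<v = sym (trans (cong (λ z → window z 1 (length r + i)) w≡rvs) (trans (window-++ʳ r (v ++ s) 1 i) (window-++ˡ v s i i<v)))

    last-of-X : ∀ y t → dropWhile once? (reverse w) ≡ y ∷ t →
                length X ≡ suc (length t) × length t < length w × window w 1 (length t) ≡ [ y ]
    last-of-X y t e = X≡1+p₀ , <-≤-trans (≤-reflexive (sym X≡1+p₀)) (≤-trans (m≤m+n (length X) (length s)) (≤-reflexive X+s≡w)) , at-p₀
      where
      X≡ : X ≡ reverse t ++ [ y ]
      X≡ = trans (cong reverse e) (unfold-reverse y t)
      X≡1+p₀ : length X ≡ suc (length t)
      X≡1+p₀ = trans (cong length X≡) (trans (length-++ (reverse t)) (trans (cong (_+ 1) (length-reverse t)) (+-comm (length t) 1)))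
      at-p₀ : window w 1 (length t) ≡ [ y ]
      at-p₀ = trans (cong (λ z → window z 1 (length t)) w≡X++s)
        (trans (window-++ˡ X s (length t) (≤-reflexive (sym X≡1+p₀)))
        (trans (cong (λ z → window z 1 (length t)) X≡)
        (trans (cong (window (reverse t ++ [ y ]) 1) (sym (trans (+-identityʳ _) (length-reverse t)))) (window-++ʳ (reverse t) [ y ] 1 0))))

    last-letter-repeats : ∃ λ i → i < length v ∸ 1 × window v 1 i ≡ window v 1 (length v ∸ 1)
    last-letter-repeats with before-s
    ... | y , t , e , ¬once-y with last-of-X y t e
    ...   | X≡1+p₀ , p₀<w , at-p₀ with another-occurrence y (length t) ¬once-y p₀<w at-p₀
    ...     | q , q<w , q≢p₀ , at-q = q ∸ length r , q′<last , earlier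
      where
      p₀ = length t
      same : window w 1 p₀ ≡ window w 1 q
      same = trans at-p₀ (sym at-q)
      r≤q : length r ≤ q
      r≤q = ≮⇒≥ λ q<r → q≢p₀ (sym (unique-r q q<r p₀ p₀<w same))
      q<p₀ : q < p₀
      q<p₀ with <-cmp q p₀
      ... | tri< q<p₀ _ _ = q<p₀
      ... | tri≈ _ q≡p₀ _ = ⊥-elim (q≢p₀ q≡p₀)
      ... | tri> _ _ p₀<q = ⊥-elim (q≢p₀ (sym (unique-s q (≤-trans (≤-reflexive X≡1+p₀) p₀<q) q<w p₀ p₀<w same)))
      last≡p₀ : length r + (length v ∸ 1) ≡ p₀
      last≡p₀ = suc-injective (trans (sym (+-suc (length r) (length v ∸ 1)))
                  (trans (cong (length r +_) (trans (+-comm 1 (length v ∸ 1)) (m∸n+n≡m v≢[]))) (trans r+v≡X X≡1+p₀)))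
      q≡ : length r + (q ∸ length r) ≡ q
      q≡ = m+[n∸m]≡n r≤q
      q′<last : q ∸ length r < length v ∸ 1
      q′<last = +-cancelˡ-< (length r) _ _ (subst₂ _<_ (sym q≡) (sym last≡p₀) q<p₀)
      last<v : length v ∸ 1 < length v
      last<v = ∸-monoʳ-< (s≤s z≤n) v≢[]
      earlier : window v 1 (q ∸ length r) ≡ window v 1 (length v ∸ 1)
      earlier = trans (window-v _ (<-trans q′<last last<v))
                (trans (cong (window w 1) q≡) (trans (sym same)
                (trans (cong (window w 1) (sym last≡p₀)) (sym (window-v _ last<v)))))

    K>1 : ∀ K → IsK _≟_ v K → 1 < K
    K>1 K isK = ≰⇒> λ K≤1 → not-unique (proj₂ (suffixUnique⇔K K isK 1 v≢[]) K≤1)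
      where
      open Branching _≟_ v using (SuffixUnique; suffixUnique⇔K)
      not-unique : ¬ SuffixUnique 1
      not-unique unique = unique (proj₁ last-letter-repeats) (proj₁ (proj₂ last-letter-repeats)) (proj₂ (proj₂ last-letter-repeats))

-- Theorem 3.1.  The case split uses a helper function rather than `with`, which would also
-- abstract the decision inside the definition of heart.
theorem3p1 : {A : Set} (_≟_ : DecidableEquality A) (w : List A) → w ≢ [] →
    (R K : ℕ) → IsR _≟_ (heart _≟_ w) R → IsK _≟_ (heart _≟_ w) K →
    (GT _≟_ w → length w + 2 ≡ R + K + alphSize _≟_ w)
    × (length w + 2 ≡ R + K + alphSize _≟_ w → GT _≟_ w)
theorem3p1 {A} _≟_ w w≢[] R K isR isK = by-cases (alphSize _≟_ w <? length w)
  where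
  open HeartFrame _≟_ w
  Claim : Set
  Claim = (GT _≟_ w → length w + 2 ≡ R + K + alphSize _≟_ w) × (length w + 2 ≡ R + K + alphSize _≟_ w → GT _≟_ w)
  nonempty : (xs : List A) → xs ≢ [] → 1 ≤ length xs
  nonempty []      xs≢[] = ⊥-elim (xs≢[] refl)
  nonempty (_ ∷ _) _     = s≤s z≤n
  by-cases : Dec (alphSize _≟_ w < length w) → Claim
  -- Some letter repeats: w = r v s around its non-empty heart v, and K > 1.
  by-cases (yes repeated) =
    Criterion.criterion _≟_ w r v s w≡rvs unique-r (λ p r+v≤p → unique-s p (subst (_≤ p) r+v≡X r+v≤p))
                        v≢[] R K isR′ isK′ (inj₁ (K>1 K isK′))
    where
    open Repeated repeated
    isR′ : IsR _≟_ v R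
    isR′ = subst (λ u → IsR _≟_ u R) heart≡v isR
    isK′ : IsK _≟_ v K
    isK′ = subst (λ u → IsK _≟_ u K) heart≡v isK
  -- All letters are distinct: w is its own heart, framed by empty words, and R = 1.
  by-cases (no distinct) =
    Criterion.criterion _≟_ w [] w [] (sym (++-identityʳ w)) (λ p ()) (λ p w≤p p<w → ⊥-elim (<⇒≱ p<w w≤p))
                        (nonempty w w≢[]) R K isR′ isK′ (inj₂ (distinct⇒R≡1 distinct R isR′))
    where
    isR′ : IsR _≟_ w R
    isR′ = subst (λ u → IsR _≟_ u R) (heart-distinct distinct) isR
    isK′ : IsK _≟_ w K
    isK′ = subst (λ u → IsK _≟_ u K) (heart-distinct distinct) isK
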